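{- Let $q$ be a prime power, let $2\le m < k$ be integers, and let $L$ be an $(m \times k)$-system over $\mathbb{F}_q$. If there exist $n \ge 1$ and a balanced function $f: \mathbb{F}_q^n \rightarrow [-\frac 12, \frac 12]$ such that $\sum_{B \in \mathcal{C}(L)} \Lambda_{L_B} (f) <0$, then $L$ is uncommon.
   Context: A system of $m$ linear forms in $k$ variables over $\mathbb{F}_q$ is identified with its $m\times k$ coefficient matrix; it is an $(m\times k)$-system if the rows are linearly independent over $\mathbb{F}_q$. For $A\subseteq\mathbb{F}_q^n$, $\mathrm{sol}(L;A)=\{\mathbf{x}\in A^k: L\mathbf{x}^T=0\}$. For $B=\{i_1<\dots<i_\ell\}\subseteq[k]$ and an $\ell$-variable system $L'$, $L$ induces $L'$ on $B$ if for every $\mathbf{x}\in\mathbb{F}_q^k$, $L(\mathbf{x})=0$ implies $L'(x_{i_1},\dots,x_{i_\ell})=0$. The length of an equation is its number of nonzero coefficients; $s(L)$ is the minimal length of a (nontrivial) equation induced by $L$; $c(L)=s(L)$ if $s(L)$ is even and $c(L)=s(L)+1$ otherwise. $B\subseteq[k]$ is critical if $|B|=c(L)$ and some (nontrivial) system is induced by $L$ on $B$; $\mathcal{C}(L)$ is the family of critical sets. For $B\in\mathcal{C}(L)$, $m_B$ is the maximal $m'$ such that an $(m'\times|B|)$-system is induced by $L$ on $B$, and $L_B$ is the $(m_B\times|B|)$-system induced by $L$ on $B$ (unique up to row operations). For a $k'$-variable system $L'$ and $f:\mathbb{F}_q^n\to\mathbb{R}$, $\Lambda_{L'}(f)=\frac{1}{|\mathrm{sol}(L';\mathbb{F}_q^n)|}\sum_{\mathbf{x}\in\mathrm{sol}(L';\mathbb{F}_q^n)}\prod_{i=1}^{k'}f(x_i)$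 and $\Delta_{L'}(f)=\Lambda_{L'}(1/2+f)+\Lambda_{L'}(1/2-f)$. $f$ is balanced if $\sum_{x\in\mathbb{F}_q^n}f(x)=0$. A $k$-variable system $L$ is common if for every $n\ge1$ and every $f:\mathbb{F}_q^n\to[-1/2,1/2]$, $\Delta_L(f)\ge 2^{1-k}$; otherwise uncommon.
   Formalization: The balanced function f and the test functions in the definition of common take rational values rather than real ones. -}

module Defs where

open import Data.Nat as ℕ using (ℕ; zero; suc; _∸_)
open import Data.Nat.Primality using (Prime)
open import Data.Fin as Fin using (Fin; zero; suc; _≟_)
open import Data.Fin.Properties using () renaming (_≟_ to _≟ᶠ_)
open import Data.Vec using (Vec; lookup; tabulate)
open import Data.List using (List; []; _∷_; map; concatMap; filter; length; foldr)
open import Data.List.Membership.Propositional using (_∈_)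
open import Data.List.Relation.Unary.All using (All)
open import Data.List.Relation.Unary.Unique.Propositional using (Unique)
open import Data.Bool using (Bool; true; false; if_then_else_)
open import Data.Product using (Σ; ∃; _×_; _,_)
open import Data.Integer using (+_)
open import Data.Rational using (ℚ; 0ℚ; 1ℚ; ½; _+_; _*_; _-_; -_; _/_; _≤_; _<_)
open import Algebra.Structures using (IsCommutativeRing)
open import Relation.Binary.PropositionalEquality using (_≡_; _≢_)
open import Relation.Nullary using (¬_; ¬?)
open import Relation.Nullary.Decidable using (⌊_⌋)
open import Function.Bundles using (_⇔_)

-- Finite fields.  F_q is represented by a field structure on Fin q
-- (with propositional equality); F_q is unique up to isomorphism and
-- all notions below are invariant under field isomorphism.

record FiniteField (q : ℕ) : Set where
  field
    _+F_ _*F_ : Fin q → Fin q → Fin q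
    -F_       : Fin q → Fin q
    0F 1F     : Fin q
    isCommutativeRing : IsCommutativeRing _≡_ _+F_ _*F_ -F_ 0F 1F
    0≢1       : 0F ≢ 1F
    inverse   : ∀ x → x ≢ 0F → Σ (Fin q) λ y → (x *F y) ≡ 1F

IsPrimePower : ℕ → Set
IsPrimePower q = Σ ℕ λ p → Σ ℕ λ e → Prime p × q ≡ p ℕ.^ suc e

_∷ᶠ_ : ∀ {A : Set} {ℓ} → A → (Fin ℓ → A) → Fin (suc ℓ) → A
(a ∷ᶠ g) zero    = a
(a ∷ᶠ g) (suc i) = g i

allFuns : ∀ {A : Set} (ℓ : ℕ) → List A → List (Fin ℓ → A)
allFuns zero    xs = (λ ()) ∷ []
allFuns (suc ℓ) xs = concatMap (λ a → map (λ g → a ∷ᶠ g) (allFuns ℓ xs)) xs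

allL : ∀ {A : Set} → (A → Bool) → List A → Bool
allL p []       = true
allL p (x ∷ xs) = if p x then allL p xs else false

sumℚ : List ℚ → ℚ
sumℚ = foldr _+_ 0ℚ

prodℚ : (ℓ : ℕ) → (Fin ℓ → ℚ) → ℚ
prodℚ zero    g = 1ℚ
prodℚ (suc ℓ) g = g zero * prodℚ ℓ (λ i → g (suc i))

-- average: (number of terms, sum of terms) ↦ sum / number
-- (the number of terms is never 0 where this is used: 0 is always a solution)
avg : ℕ → ℚ → ℚ
avg zero    s = 0ℚ
avg (suc c) s = s * ((+ 1) / suc c)

halfPow : ℕ → ℚ
halfPow zero    = 1ℚ
halfPow (suc j) = ½ * halfPow j

isEven : ℕ → Bool
isEven zero          = true
isEven (suc zero)    = false
isEven (suc (suc n)) = isEven n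

cOf : ℕ → ℕ
cOf s = if isEven s then s else suc s

module _ {q : ℕ} (𝔽 : FiniteField q) where
  open FiniteField 𝔽

  F : Set
  F = Fin q

  Sys : ℕ → ℕ → Set
  Sys m k = Fin m → Fin k → F

  ΣF : (ℓ : ℕ) → (Fin ℓ → F) → F
  ΣF zero    g = 0F
  ΣF (suc ℓ) g = g zero +F ΣF ℓ (λ i → g (suc i))

  LinIndep : ∀ {m k} → Sys m k → Set
  LinIndep {m} {k} L =
    (c : Fin m → F) → (∀ j → ΣF m (λ i → c i *F L i j) ≡ 0F) → ∀ i → c i ≡ 0F

  Kills : ∀ {m k} → Sys m k → (Fin k → F) → Set
  Kills {m} {k} L x = ∀ i → ΣF k (λ j → L i j *F x j) ≡ 0F

  StrictInc : ∀ {k ℓ} → Vec (Fin k) ℓ → Set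
  StrictInc {k} {ℓ} B = ∀ (a b : Fin ℓ) → a Fin.< b → lookup B a Fin.< lookup B b

  -- L induces L' on B = {i_1 < … < i_ℓ} (B given as the increasing vector)
  Induces : ∀ {m k m' ℓ} → Sys m k → Vec (Fin k) ℓ → Sys m' ℓ → Set
  Induces {k = k} L B L' = ∀ (x : Fin k → F) → Kills L x → Kills L' (λ t → x (lookup B t))

  Nontrivial : ∀ {ℓ} → (Fin ℓ → F) → Set
  Nontrivial e = ∃ λ j → e j ≢ 0F

  eqLength : ∀ {ℓ} → (Fin ℓ → F) → ℕ
  eqLength {ℓ} e = length (filter (λ j → ¬? (e j ≟ᶠ 0F)) (Data.Vec.toList (tabulate {n = ℓ} (λ i → i))))

  fullSet : (k : ℕ) → Vec (Fin k) k
  fullSet k = tabulate (λ i → i)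

  InducedEq : ∀ {m k} → Sys m k → (Fin k → F) → Set
  InducedEq {k = k} L e = Nontrivial e × Induces L (fullSet k) (λ (_ : Fin 1) → e)

  IsMinLength : ∀ {m k} → Sys m k → ℕ → Set
  IsMinLength {k = k} L s =
    (∃ λ (e : Fin k → F) → InducedEq L e × eqLength e ≡ s)
    × (∀ (e : Fin k → F) → InducedEq L e → s ℕ.≤ eqLength e)

  Critical : ∀ {m k} → Sys m k → (c : ℕ) → Vec (Fin k) c → Set
  Critical L c B = StrictInc B ×
    ∃ λ m' → 1 ℕ.≤ m' × Σ (Sys m' c) λ M → LinIndep M × Induces L B M

  IsLB : ∀ {m k c m'} → Sys m k → Vec (Fin k) c → Sys m' c → Set
  IsLB {c = c} {m' = m'} L B M = LinIndep M × Induces L B M ×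
    (∀ m'' → m' ℕ.< m'' → (M'' : Sys m'' c) → LinIndep M'' → ¬ Induces L B M'')

  -- entries of an enumeration of C(L) together with the chosen L_B
  record CritEntry (k c : ℕ) : Set where
    constructor entry
    field
      set  : Vec (Fin k) c
      rows : ℕ
      sys  : Sys rows c
  open CritEntry public

  EnumeratesCrit : ∀ {m k} → Sys m k → (c : ℕ) → List (CritEntry k c) → Set
  EnumeratesCrit {k = k} L c es =
    Unique (map set es)
    × (∀ (B : Vec (Fin k) c) → Critical L c B ⇔ (B ∈ map set es))
    × All (λ e → IsLB L (set e) (sys e)) es

  Pt : ℕ → Set
  Pt n = Fin n → F

  allPts : (n : ℕ) → List (Pt n)
  allPts n = allFuns n (Data.Vec.toList (tabulate (λ i → i)))

  isSol : ∀ {m' ℓ n} → Sys m' ℓ → (Fin ℓ → Pt n) → Bool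
  isSol {m'} {ℓ} {n} M x =
    allL (λ i → allL (λ t → ⌊ ΣF ℓ (λ j → M i j *F x j t) ≟ᶠ 0F ⌋)
                   (Data.Vec.toList (tabulate {n = n} (λ t → t))))
        (Data.Vec.toList (tabulate {n = m'} (λ i → i)))

  sols : ∀ {m' ℓ} → Sys m' ℓ → (n : ℕ) → List (Fin ℓ → Pt n)
  sols {ℓ = ℓ} M n = filter (λ x → isSol M x Data.Bool.≟ true) (allFuns ℓ (allPts n))

  Λ : ∀ {m' ℓ n} → Sys m' ℓ → (Pt n → ℚ) → ℚ
  Λ {ℓ = ℓ} {n} M f =
    avg (length (sols M n)) (sumℚ (map (λ x → prodℚ ℓ (λ i → f (x i))) (sols M n)))

  Δ : ∀ {m' ℓ n} → Sys m' ℓ → (Pt n → ℚ) → ℚ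
  Δ M f = Λ M (λ x → ½ + f x) + Λ M (λ x → ½ - f x)

  Bounded : ∀ {n} → (Pt n → ℚ) → Set
  Bounded f = ∀ x → (- ½ ≤ f x) × (f x ≤ ½)

  Balanced : ∀ {n} → (Pt n → ℚ) → Set
  Balanced {n} f = sumℚ (map f (allPts n)) ≡ 0ℚ

  Common : ∀ {m k} → Sys m k → Set
  Common {k = k} L = ∀ (n : ℕ) → 1 ℕ.≤ n → (f : Pt n → ℚ) → Bounded f →
    halfPow (k ∸ 1) ≤ Δ L f

  Uncommon : ∀ {m k} → Sys m k → Set
  Uncommon L = ¬ Common L

  sumΛ : ∀ {k c n} → List (CritEntry k c) → (Pt n → ℚ) → ℚ
  sumΛ es f = sumℚ (map (λ e → Λ (sys e) f) es)

{-# OPTIONS --safe #-}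

-- Put β = 2ε. Expanding the products in Λ_L(½ ± εf) gives
--   Δ_L(εf) = 2^{-k} Σ_{B ⊆ [k]} (β^|B| + (-β)^|B|) E_{x ∈ sol(L)} Π_{t ∈ B} f(x_t).
-- Odd |B| cancel and B = ∅ contributes 2. If no equation is induced on a nonempty B (every B with
-- |B| < s(L), and every non-critical B with |B| = c(L)), Fredholm's alternative shows that every
-- assignment on B extends to a solution of L; the fibres of sol(L) → 𝔽^B are translates of each
-- other, so the term factors into averages of the balanced f and vanishes. For critical B the same
-- argument, with sol(L_B) in place of 𝔽^B, turns the term into Λ_{L_B}(f). The sets with |B| > c(L)
-- contribute O(ε^{c(L)+1}), so Δ_L(εf) ≤ 2^{1-k}(1 + β^{c(L)} Σ_B Λ_{L_B}(f) + O(ε^{c(L)+1})),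
-- which drops below 2^{1-k} for small ε > 0.

module Submission where

open import Defs
open import Data.Nat using (ℕ; _≤_; _<_)
open import Data.Product using (Σ; ∃; _×_)
open import Data.List using (List)
open import Data.Rational using (ℚ; 0ℚ) renaming (_<_ to _<ℚ_)

open import Algebra.Bundles using (CommutativeRing)
import Algebra.Properties.CommutativeMonoid.Sum as CommutativeMonoidSum
import Algebra.Properties.CommutativeSemiring.Exp as ExpProperties
open import Data.Bool using (Bool; true; false; if_then_else_) renaming (_≟_ to _≟ᵇ_)
open import Data.Empty using (⊥-elim)
open import Data.Fin as Fin using (Fin; zero; suc; _↑ˡ_; _↑ʳ_; splitAt)
import Data.Fin.Properties as FinP
open import Data.Fin.Properties using () renaming (_≟_ to _≟ᶠ_)
open import Data.Fin.Permutation using (Permutation; permutation)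
import Data.Integer as ℤ
import Data.Integer.Properties as ℤP
open import Data.Integer.Solver using () renaming (module +-*-Solver to ℤSolver)
open import Data.List using ([]; _∷_; map; filter; length; _++_; concatMap)
import Data.List.Properties as ListP
open import Data.List.Membership.Propositional using (_∈_; find)
import Data.List.Membership.Propositional.Properties as ∈
open import Data.List.Relation.Unary.All as All using (All; []; _∷_)
open import Data.List.Relation.Unary.All.Properties using (All¬⇒¬Any)
open import Data.List.Relation.Unary.AllPairs as AllPairs using (AllPairs; []; _∷_)
import Data.List.Relation.Unary.AllPairs.Properties as AllPairsP
open import Data.List.Relation.Unary.Any as Any using (here; there)
open import Data.List.Relation.Unary.Unique.Propositional using (Unique)
open import Data.Nat as ℕ using (zero; suc; _∸_; z≤n; s≤s)
import Data.Nat.Properties as ℕ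
open import Data.Product using (_,_; proj₁; proj₂)
open import Data.Rational as ℚ using (1ℚ; ½; _+_; _*_; _-_; -_; _/_; ∣_∣; _⊓_) renaming (_≤_ to _≤ℚ_)
import Data.Rational.Properties as ℚ
open import Data.Rational.Solver using (module +-*-Solver)
import Data.Rational.Unnormalised as ℚᵘ
import Data.Rational.Unnormalised.Properties as ℚᵘ
open import Data.Sum as Sum using (_⊎_; inj₁; inj₂)
open import Data.Vec as Vec using (Vec; []; _∷_; lookup; toList)
import Data.Vec.Properties as VecP
open import Data.Vec.Functional using (zipWith)
open import Data.Vec.Functional.Relation.Binary.Pointwise using (Pointwise)
open import Data.Vec.Membership.Propositional.Properties using (∈-tabulate⁺; ∈-toList⁺)
open import Function using (_∘_; id)
open import Function.Bundles using (_⇔_; Equivalence)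
open import Relation.Binary.Definitions using (DecidableEquality; tri<; tri≈; tri>)
open import Relation.Binary.PropositionalEquality
open import Relation.Nullary using (¬_; ¬?; Dec; yes; no; does)
open import Relation.Nullary.Decidable using (⌊_⌋; dec-true; dec-false; decidable-stable)

open import Algebra.Definitions.RawSemiring ℚ.+-*-rawSemiring using (_^_)
open import Algebra.Properties.Group ℚ.+-0-group using () renaming (⁻¹-involutive to neg-involutive)
open ExpProperties (CommutativeRing.commutativeSemiring ℚ.+-*-commutativeRing) using (^-distrib-*; ^-congˡ)
module ℕSum = CommutativeMonoidSum ℕ.+-0-commutativeMonoid
module ℚSum = CommutativeMonoidSum ℚ.+-0-commutativeMonoid


∑ : ∀ {A : Set} → List A → (A → ℚ) → ℚ
∑ xs g = sumℚ (map g xs)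

𝟙 : Bool → ℚ
𝟙 true  = 1ℚ
𝟙 false = 0ℚ

0≤𝟙 : ∀ b → 0ℚ ≤ℚ 𝟙 b
0≤𝟙 true  = ℚ.nonNegative⁻¹ 1ℚ
0≤𝟙 false = ℚ.≤-refl

fromℕ : ℕ → ℚ
fromℕ zero    = 0ℚ
fromℕ (suc n) = 1ℚ + fromℕ n

module _ {A : Set} where

  ∑-cong : ∀ (xs : List A) {g h : A → ℚ} → (∀ x → g x ≡ h x) → ∑ xs g ≡ ∑ xs h
  ∑-cong []       g≡h = refl
  ∑-cong (x ∷ xs) g≡h = cong₂ _+_ (g≡h x) (∑-cong xs g≡h)

  ∑-cong-∈ : ∀ (xs : List A) {g h : A → ℚ} → (∀ x → x ∈ xs → g x ≡ h x) → ∑ xs g ≡ ∑ xs h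
  ∑-cong-∈ []       g≡h = refl
  ∑-cong-∈ (x ∷ xs) g≡h = cong₂ _+_ (g≡h x (here refl)) (∑-cong-∈ xs (λ y y∈ → g≡h y (there y∈)))

  ∑-mono-≤ : ∀ (xs : List A) {g h : A → ℚ} → (∀ x → x ∈ xs → g x ≤ℚ h x) → ∑ xs g ≤ℚ ∑ xs h
  ∑-mono-≤ []       g≤h = ℚ.≤-refl
  ∑-mono-≤ (x ∷ xs) g≤h = ℚ.+-mono-≤ (g≤h x (here refl)) (∑-mono-≤ xs (λ y y∈ → g≤h y (there y∈)))

  ∑-zero : ∀ (xs : List A) → ∑ xs (λ _ → 0ℚ) ≡ 0ℚ
  ∑-zero []       = refl
  ∑-zero (x ∷ xs) = trans (ℚ.+-identityˡ _) (∑-zero xs)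

  ∑-distrib-+ : ∀ (xs : List A) (g h : A → ℚ) → ∑ xs (λ x → g x + h x) ≡ ∑ xs g + ∑ xs h
  ∑-distrib-+ []       g h = refl
  ∑-distrib-+ (x ∷ xs) g h = begin
    (g x + h x) + ∑ xs (λ y → g y + h y)  ≡⟨ cong ((g x + h x) +_) (∑-distrib-+ xs g h) ⟩
    (g x + h x) + (∑ xs g + ∑ xs h)       ≡⟨ solve 4 (λ a b c d → (a :+ b) :+ (c :+ d) := (a :+ c) :+ (b :+ d)) refl (g x) (h x) _ _ ⟩
    (g x + ∑ xs g) + (h x + ∑ xs h)       ∎
    where
    open ≡-Reasoning
    open +-*-Solver

  ∑-*ˡ : ∀ (xs : List A) (c : ℚ) (g : A → ℚ) → ∑ xs (λ x → c * g x) ≡ c * ∑ xs g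
  ∑-*ˡ []       c g = sym (ℚ.*-zeroʳ c)
  ∑-*ˡ (x ∷ xs) c g = trans (cong (c * g x +_) (∑-*ˡ xs c g)) (sym (ℚ.*-distribˡ-+ c (g x) _))

  ∑-*ʳ : ∀ (xs : List A) (c : ℚ) (g : A → ℚ) → ∑ xs (λ x → g x * c) ≡ ∑ xs g * c
  ∑-*ʳ xs c g = trans (∑-cong xs (λ x → ℚ.*-comm (g x) c)) (trans (∑-*ˡ xs c g) (ℚ.*-comm c _))

  ∑-++ : ∀ (xs ys : List A) (g : A → ℚ) → ∑ (xs ++ ys) g ≡ ∑ xs g + ∑ ys g
  ∑-++ []       ys g = sym (ℚ.+-identityˡ _)
  ∑-++ (x ∷ xs) ys g = trans (cong (g x +_) (∑-++ xs ys g)) (sym (ℚ.+-assoc (g x) _ _))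

  ∑-const : ∀ (xs : List A) (c : ℚ) → ∑ xs (λ _ → c) ≡ fromℕ (length xs) * c
  ∑-const []       c = sym (ℚ.*-zeroˡ c)
  ∑-const (x ∷ xs) c = begin
    c + ∑ xs (λ _ → c)           ≡⟨ cong₂ _+_ (sym (ℚ.*-identityˡ c)) (∑-const xs c) ⟩
    1ℚ * c + fromℕ (length xs) * c  ≡⟨ sym (ℚ.*-distribʳ-+ c 1ℚ (fromℕ (length xs))) ⟩
    fromℕ (suc (length xs)) * c  ∎
    where open ≡-Reasoning

  ∑-filter : ∀ {P : A → Set} (P? : ∀ x → Dec (P x)) (xs : List A) (g : A → ℚ) →
             ∑ (filter P? xs) g ≡ ∑ xs (λ x → 𝟙 (does (P? x)) * g x)
  ∑-filter P? []       g = refl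
  ∑-filter P? (x ∷ xs) g with does (P? x)
  ... | true  = cong₂ _+_ (sym (ℚ.*-identityˡ (g x))) (∑-filter P? xs g)
  ... | false = trans (∑-filter P? xs g) (trans (sym (ℚ.+-identityˡ _)) (cong (_+ _) (sym (ℚ.*-zeroˡ (g x)))))

  length-filter : ∀ {P : A → Set} (P? : ∀ x → Dec (P x)) (xs : List A) →
                  fromℕ (length (filter P? xs)) ≡ ∑ xs (λ x → 𝟙 (does (P? x)))
  length-filter P? []       = refl
  length-filter P? (x ∷ xs) with does (P? x)
  ... | true  = cong (1ℚ +_) (length-filter P? xs)
  ... | false = trans (length-filter P? xs) (sym (ℚ.+-identityˡ _))

module _ {A B : Set} where

  ∑-map : ∀ (f : A → B) (xs : List A) (g : B → ℚ) → ∑ (map f xs) g ≡ ∑ xs (g ∘ f)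
  ∑-map f []       g = refl
  ∑-map f (x ∷ xs) g = cong (g (f x) +_) (∑-map f xs g)

  ∑-comm : ∀ (xs : List A) (ys : List B) (h : A → B → ℚ) →
           ∑ xs (λ x → ∑ ys (h x)) ≡ ∑ ys (λ y → ∑ xs (λ x → h x y))
  ∑-comm []       ys h = sym (∑-zero ys)
  ∑-comm (x ∷ xs) ys h = trans (cong (∑ ys (h x) +_) (∑-comm xs ys h))
                               (sym (∑-distrib-+ ys (h x) (λ y → ∑ xs (λ x′ → h x′ y))))

  ∑-concatMap : ∀ (f : A → List B) (xs : List A) (g : B → ℚ) →
                ∑ (concatMap f xs) g ≡ ∑ xs (λ x → ∑ (f x) g)
  ∑-concatMap f []       g = refl
  ∑-concatMap f (x ∷ xs) g = trans (∑-++ (f x) (concatMap f xs) g) (cong (∑ (f x) g +_) (∑-concatMap f xs g))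

fromℕ-toℚᵘ : ∀ n → ℚ.toℚᵘ (fromℕ n) ℚᵘ.≃ ℚᵘ.mkℚᵘ (ℤ.+ n) 0
fromℕ-toℚᵘ zero    = ℚᵘ.*≡* refl
fromℕ-toℚᵘ (suc n) = begin
  ℚ.toℚᵘ (1ℚ + fromℕ n)               ≈⟨ ℚ.toℚᵘ-homo-+ 1ℚ (fromℕ n) ⟩
  ℚᵘ.1ℚᵘ ℚᵘ.+ ℚ.toℚᵘ (fromℕ n)        ≈⟨ ℚᵘ.+-congʳ ℚᵘ.1ℚᵘ (fromℕ-toℚᵘ n) ⟩
  ℚᵘ.1ℚᵘ ℚᵘ.+ ℚᵘ.mkℚᵘ (ℤ.+ n) 0       ≈⟨ ℚᵘ.*≡* numerators ⟩
  ℚᵘ.mkℚᵘ (ℤ.+ suc n) 0               ∎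
  where
  open ℚᵘ.≃-Reasoning
  open ℤSolver
  numerators : (ℤ.+ 1 ℤ.* ℤ.+ 1 ℤ.+ ℤ.+ n ℤ.* ℤ.+ 1) ℤ.* ℤ.+ 1 ≡ ℤ.+ suc n ℤ.* (ℤ.+ 1 ℤ.* ℤ.+ 1)
  numerators = trans (solve 1 (λ m → (con (ℤ.+ 1) :* con (ℤ.+ 1) :+ m :* con (ℤ.+ 1)) :* con (ℤ.+ 1)
                                     := (con (ℤ.+ 1) :+ m) :* (con (ℤ.+ 1) :* con (ℤ.+ 1))) refl (ℤ.+ n))
                     (cong (ℤ._* (ℤ.+ 1 ℤ.* ℤ.+ 1)) (sym (ℤP.pos-+ 1 n)))

fromℕ-*-avg-one : ∀ c → fromℕ (suc c) * avg (suc c) 1ℚ ≡ 1ℚ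
fromℕ-*-avg-one c = ℚ.toℚᵘ-injective (begin
  ℚ.toℚᵘ (fromℕ (suc c) * (1ℚ * r))                    ≈⟨ ℚᵘ.≃-reflexive (cong (λ x → ℚ.toℚᵘ (fromℕ (suc c) * x)) (ℚ.*-identityˡ r)) ⟩
  ℚ.toℚᵘ (fromℕ (suc c) * r)                           ≈⟨ ℚ.toℚᵘ-homo-* (fromℕ (suc c)) r ⟩
  ℚ.toℚᵘ (fromℕ (suc c)) ℚᵘ.* ℚ.toℚᵘ r                 ≈⟨ ℚᵘ.*-cong (fromℕ-toℚᵘ (suc c)) (ℚ.toℚᵘ-fromℚᵘ (ℚᵘ.mkℚᵘ (ℤ.+ 1) c)) ⟩
  ℚᵘ.mkℚᵘ (ℤ.+ suc c) 0 ℚᵘ.* ℚᵘ.mkℚᵘ (ℤ.+ 1) c        ≈⟨ ℚᵘ.*≡* numerators ⟩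
  ℚ.toℚᵘ 1ℚ                                            ∎)
  where
  open ℚᵘ.≃-Reasoning
  r : ℚ
  r = (ℤ.+ 1) / suc c
  numerators : (ℤ.+ suc c ℤ.* ℤ.+ 1) ℤ.* ℤ.+ 1 ≡ ℤ.+ 1 ℤ.* ℤ.+ (1 ℕ.* suc c)
  numerators = trans (ℤP.*-identityʳ _) (trans (ℤP.*-identityʳ _)
                 (trans (cong ℤ.+_ (sym (ℕ.*-identityˡ (suc c)))) (sym (ℤP.*-identityˡ _))))

avg-* : ∀ N S → avg N S ≡ S * avg N 1ℚ
avg-* zero    S = sym (ℚ.*-zeroʳ S)
avg-* (suc c) S = cong (S *_) (sym (ℚ.*-identityˡ _))

avg-zero : ∀ N → avg N 0ℚ ≡ 0ℚ
avg-zero N = trans (avg-* N 0ℚ) (ℚ.*-zeroˡ (avg N 1ℚ))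

avg-cross : ∀ NL NM SL SM → 1 ≤ NL → 1 ≤ NM →
            fromℕ NM * SL ≡ fromℕ NL * SM → avg NL SL ≡ avg NM SM
avg-cross (suc cL) (suc cM) SL SM _ _ cross = begin
  avg (suc cL) SL         ≡⟨ avg-* (suc cL) SL ⟩
  SL * rL                 ≡⟨ sym (ℚ.*-identityʳ _) ⟩
  SL * rL * 1ℚ            ≡⟨ cong (SL * rL *_) (sym (fromℕ-*-avg-one cM)) ⟩
  SL * rL * (nM * rM)     ≡⟨ solve 4 (λ a b c d → a :* b :* (c :* d) := (c :* a) :* (b :* d)) refl SL rL nM rM ⟩
  (nM * SL) * (rL * rM)   ≡⟨ cong (_* (rL * rM)) cross ⟩
  (nL * SM) * (rL * rM)   ≡⟨ solve 4 (λ a b c d → (a :* b) :* (c :* d) := b :* d :* (a :* c)) refl nL SM rL rM ⟩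
  SM * rM * (nL * rL)     ≡⟨ cong (SM * rM *_) (fromℕ-*-avg-one cL) ⟩
  SM * rM * 1ℚ            ≡⟨ ℚ.*-identityʳ _ ⟩
  SM * rM                 ≡⟨ sym (avg-* (suc cM) SM) ⟩
  avg (suc cM) SM         ∎
  where
  open ≡-Reasoning
  open +-*-Solver
  rL rM nL nM : ℚ
  rL = avg (suc cL) 1ℚ
  rM = avg (suc cM) 1ℚ
  nL = fromℕ (suc cL)
  nM = fromℕ (suc cM)

module _ {A : Set} where

  avg-∑-const : ∀ (xs : List A) c → 1 ≤ length xs → avg (length xs) (∑ xs (λ _ → c)) ≡ c
  avg-∑-const xs@(_ ∷ xs′) c _ = begin
    avg (length xs) (∑ xs (λ _ → c))            ≡⟨ cong (avg (length xs)) (∑-const xs c) ⟩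
    avg (length xs) (fromℕ (length xs) * c)     ≡⟨ avg-* (length xs) (fromℕ (length xs) * c) ⟩
    fromℕ (length xs) * c * avg (length xs) 1ℚ  ≡⟨ solve 3 (λ n c r → n :* c :* r := c :* (n :* r)) refl (fromℕ (length xs)) c (avg (length xs) 1ℚ) ⟩
    c * (fromℕ (length xs) * avg (length xs) 1ℚ) ≡⟨ cong (c *_) (fromℕ-*-avg-one (length xs′)) ⟩
    c * 1ℚ                                      ≡⟨ ℚ.*-identityʳ c ⟩
    c                                           ∎
    where
    open ≡-Reasoning
    open +-*-Solver

  avg-≤ : ∀ (xs : List A) (g : A → ℚ) K → 1 ≤ length xs → (∀ x → x ∈ xs → g x ≤ℚ K) →
          avg (length xs) (∑ xs g) ≤ℚ K
  avg-≤ xs@(_ ∷ xs′) g K xs≢[] g≤K = begin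
    avg (length xs) (∑ xs g)            ≡⟨ avg-* (length xs) (∑ xs g) ⟩
    ∑ xs g * avg (length xs) 1ℚ          ≤⟨ ℚ.*-monoʳ-≤-nonNeg (avg (length xs) 1ℚ) {{avg-nonNeg}} (∑-mono-≤ xs g≤K) ⟩
    ∑ xs (λ _ → K) * avg (length xs) 1ℚ  ≡⟨ sym (avg-* (length xs) (∑ xs (λ _ → K))) ⟩
    avg (length xs) (∑ xs (λ _ → K))    ≡⟨ avg-∑-const xs K xs≢[] ⟩
    K                                   ∎
    where
    open ℚ.≤-Reasoning
    avg-nonNeg : ℚ.NonNegative (avg (length xs) 1ℚ)
    avg-nonNeg = ℚ.nonNeg*nonNeg⇒nonNeg 1ℚ ((ℤ.+ 1) / suc (length xs′)) {{ℚ.normalize-nonNeg 1 (length xs)}}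

two : ℚ
two = 1ℚ + 1ℚ

0<two : 0ℚ <ℚ two
0<two = ℚ.positive⁻¹ two

halfPow≡½^ : ∀ j → halfPow j ≡ ½ ^ j
halfPow≡½^ zero    = refl
halfPow≡½^ (suc j) = cong (½ *_) (halfPow≡½^ j)

*-mono-≤-nonNeg : ∀ {p p′ r r′} → 0ℚ ≤ℚ p → 0ℚ ≤ℚ r′ → p ≤ℚ p′ → r ≤ℚ r′ → p * r ≤ℚ p′ * r′
*-mono-≤-nonNeg {p} {p′} {r} {r′} 0≤p 0≤r′ p≤p′ r≤r′ =
  ℚ.≤-trans (ℚ.*-monoˡ-≤-nonNeg p {{ℚ.nonNegative 0≤p}} r≤r′) (ℚ.*-monoʳ-≤-nonNeg r′ {{ℚ.nonNegative 0≤r′}} p≤p′)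

*-nonNeg : ∀ {p r} → 0ℚ ≤ℚ p → 0ℚ ≤ℚ r → 0ℚ ≤ℚ p * r
*-nonNeg {p} {r} 0≤p 0≤r = ℚ.nonNegative⁻¹ (p * r) {{ℚ.nonNeg*nonNeg⇒nonNeg p {{ℚ.nonNegative 0≤p}} r {{ℚ.nonNegative 0≤r}}}}

^-nonNeg : ∀ {x} j → 0ℚ ≤ℚ x → 0ℚ ≤ℚ x ^ j
^-nonNeg zero    _   = ℚ.nonNegative⁻¹ 1ℚ
^-nonNeg (suc j) 0≤x = *-nonNeg 0≤x (^-nonNeg j 0≤x)

^-pos : ∀ {x} j → 0ℚ <ℚ x → 0ℚ <ℚ x ^ j
^-pos zero    _   = ℚ.positive⁻¹ 1ℚ
^-pos {x} (suc j) 0<x = ℚ.positive⁻¹ (x * x ^ j)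
  {{ℚ.pos*pos⇒pos x {{ℚ.positive 0<x}} (x ^ j) {{ℚ.positive (^-pos j 0<x)}}}}

halfPow-pos : ∀ j → 0ℚ <ℚ halfPow j
halfPow-pos j = subst (0ℚ <ℚ_) (sym (halfPow≡½^ j)) (^-pos j (ℚ.positive⁻¹ ½))

^-antitone : ∀ {x} c j → 0ℚ ≤ℚ x → x ≤ℚ 1ℚ → c ≤ j → x ^ j ≤ℚ x ^ c
^-antitone {x} zero    zero    0≤x x≤1 _ = ℚ.≤-refl
^-antitone {x} zero    (suc j) 0≤x x≤1 _ =
  subst (x * x ^ j ≤ℚ_) (ℚ.*-identityˡ 1ℚ) (*-mono-≤-nonNeg 0≤x (ℚ.nonNegative⁻¹ 1ℚ) x≤1 (^-antitone 0 j 0≤x x≤1 z≤n))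
^-antitone {x} (suc c) (suc j) 0≤x x≤1 (s≤s c≤j) = ℚ.*-monoˡ-≤-nonNeg x {{ℚ.nonNegative 0≤x}} (^-antitone c j 0≤x x≤1 c≤j)

1≤two^ : ∀ k → 1ℚ ≤ℚ two ^ k
1≤two^ zero    = ℚ.≤-refl
1≤two^ (suc k) = *-mono-≤-nonNeg (ℚ.nonNegative⁻¹ 1ℚ) (ℚ.<⇒≤ (^-pos k 0<two)) (ℚ.<⇒≤ 1<two) (1≤two^ k)
  where
  1<two : 1ℚ <ℚ two
  1<two = subst (_<ℚ two) (ℚ.+-identityʳ 1ℚ) (ℚ.+-monoʳ-< 1ℚ (ℚ.positive⁻¹ 1ℚ))

[x+x]^≡two^*x^ : ∀ x j → (x + x) ^ j ≡ two ^ j * x ^ j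
[x+x]^≡two^*x^ x j = trans (^-congˡ j (solve 1 (λ x → x :+ x := (con 1ℚ :+ con 1ℚ) :* x) refl x)) (^-distrib-* two x j)
  where open +-*-Solver

[x+x]^*halfPow : ∀ x j → (x + x) ^ j * halfPow j ≡ x ^ j
[x+x]^*halfPow x j = begin
  (x + x) ^ j * halfPow j   ≡⟨ cong ((x + x) ^ j *_) (halfPow≡½^ j) ⟩
  (x + x) ^ j * ½ ^ j       ≡⟨ sym (^-distrib-* (x + x) ½ j) ⟩
  ((x + x) * ½) ^ j         ≡⟨ ^-congˡ j (solve 1 (λ x → (x :+ x) :* con ½ := x) refl x) ⟩
  x ^ j                     ∎
  where
  open ≡-Reasoning
  open +-*-Solver

two^*halfPow-suc : ∀ k → two ^ k * halfPow (suc k) ≡ ½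
two^*halfPow-suc k = begin
  two ^ k * (½ * halfPow k)   ≡⟨ solve 3 (λ t h p → t :* (h :* p) := h :* (t :* p)) refl (two ^ k) ½ (halfPow k) ⟩
  ½ * (two ^ k * halfPow k)   ≡⟨ cong (½ *_) (trans (cong (two ^ k *_) (halfPow≡½^ k)) (sym (^-distrib-* two ½ k))) ⟩
  ½ * (two * ½) ^ k           ≡⟨ cong (λ y → ½ * y ^ k) (solve 0 (con two :* con ½ := con 1ℚ) refl) ⟩
  ½ * 1ℚ ^ k                  ≡⟨ cong (½ *_) (1^ k) ⟩
  ½ * 1ℚ                      ≡⟨ ℚ.*-identityʳ ½ ⟩
  ½                           ∎
  where
  open ≡-Reasoning
  open +-*-Solver
  1^ : ∀ k → 1ℚ ^ k ≡ 1ℚ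
  1^ zero    = refl
  1^ (suc k) = trans (ℚ.*-identityˡ (1ℚ ^ k)) (1^ k)

[-x]^ : ∀ x j → (- x) ^ j ≡ (if isEven j then x ^ j else - x ^ j)
[-x]^ x zero          = refl
[-x]^ x (suc zero)    = trans (ℚ.*-identityʳ (- x)) (cong -_ (sym (ℚ.*-identityʳ x)))
[-x]^ x (suc (suc j)) with isEven j | [-x]^ x j
... | true  | eq = trans (cong (λ y → (- x) * ((- x) * y)) eq)
                        (solve 2 (λ x y → (:- x) :* ((:- x) :* y) := x :* (x :* y)) refl x (x ^ j))
  where open +-*-Solver
... | false | eq = trans (cong (λ y → (- x) * ((- x) * y)) eq)
                        (solve 2 (λ x y → (:- x) :* ((:- x) :* (:- y)) := :- (x :* (x :* y))) refl x (x ^ j))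
  where open +-*-Solver

^+[-x]^-odd : ∀ x j → isEven j ≡ false → x ^ j + (- x) ^ j ≡ 0ℚ
^+[-x]^-odd x j odd = begin
  x ^ j + (- x) ^ j                                  ≡⟨ cong (x ^ j +_) ([-x]^ x j) ⟩
  x ^ j + (if isEven j then x ^ j else - x ^ j)      ≡⟨ cong (λ b → x ^ j + (if b then x ^ j else - x ^ j)) odd ⟩
  x ^ j - x ^ j                                      ≡⟨ ℚ.+-inverseʳ (x ^ j) ⟩
  0ℚ                                                 ∎
  where open ≡-Reasoning

^+[-x]^-even : ∀ x j → isEven j ≡ true → x ^ j + (- x) ^ j ≡ two * x ^ j
^+[-x]^-even x j even = begin
  x ^ j + (- x) ^ j                                  ≡⟨ cong (x ^ j +_) ([-x]^ x j) ⟩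
  x ^ j + (if isEven j then x ^ j else - x ^ j)      ≡⟨ cong (λ b → x ^ j + (if b then x ^ j else - x ^ j)) even ⟩
  x ^ j + x ^ j                                      ≡⟨ solve 1 (λ y → y :+ y := (con 1ℚ :+ con 1ℚ) :* y) refl (x ^ j) ⟩
  two * x ^ j                                        ∎
  where
  open ≡-Reasoning
  open +-*-Solver

p≤∣p∣ : ∀ p → p ≤ℚ ∣ p ∣
p≤∣p∣ p with ℚ.∣p∣≡p∨∣p∣≡-p p
... | inj₁ ∣p∣≡p  = ℚ.≤-reflexive (sym ∣p∣≡p)
... | inj₂ ∣p∣≡-p = ℚ.≤-trans p≤0 (ℚ.0≤∣p∣ p)
  where
  p≤0 : p ≤ℚ 0ℚ
  p≤0 = subst (_≤ℚ 0ℚ) (neg-involutive p) (ℚ.neg-antimono-≤ (subst (0ℚ ≤ℚ_) ∣p∣≡-p (ℚ.0≤∣p∣ p)))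

∣p∣≤q⇒-q≤p≤q : ∀ p q → ∣ p ∣ ≤ℚ q → (- q ≤ℚ p) × (p ≤ℚ q)
∣p∣≤q⇒-q≤p≤q p q ∣p∣≤q =
  subst (- q ≤ℚ_) (neg-involutive p) (ℚ.neg-antimono-≤ (ℚ.≤-trans (p≤∣p∣ (- p)) (subst (_≤ℚ q) (sym (ℚ.∣-p∣≡∣p∣ p)) ∣p∣≤q)))
  , ℚ.≤-trans (p≤∣p∣ p) ∣p∣≤q

-q≤p≤q⇒∣p∣≤q : ∀ p q → - q ≤ℚ p → p ≤ℚ q → ∣ p ∣ ≤ℚ q
-q≤p≤q⇒∣p∣≤q p q -q≤p p≤q with ℚ.∣p∣≡p∨∣p∣≡-p p
... | inj₁ ∣p∣≡p  = subst (_≤ℚ q) (sym ∣p∣≡p) p≤q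
... | inj₂ ∣p∣≡-p = subst₂ _≤ℚ_ (sym ∣p∣≡-p) (neg-involutive q) (ℚ.neg-antimono-≤ -q≤p)

prodℚ-cong : ∀ ℓ {g h : Fin ℓ → ℚ} → (∀ i → g i ≡ h i) → prodℚ ℓ g ≡ prodℚ ℓ h
prodℚ-cong zero    g≡h = refl
prodℚ-cong (suc ℓ) g≡h = cong₂ _*_ (g≡h zero) (prodℚ-cong ℓ (g≡h ∘ suc))

prodℚ-½* : ∀ k (w : Fin k → ℚ) → prodℚ k (λ i → ½ * w i) ≡ halfPow k * prodℚ k w
prodℚ-½* zero    w = sym (ℚ.*-identityˡ 1ℚ)
prodℚ-½* (suc k) w = trans (cong (½ * w zero *_) (prodℚ-½* k (w ∘ suc)))
  (solve 3 (λ a h p → (con ½ :* a) :* (h :* p) := (con ½ :* h) :* (a :* p)) refl (w zero) (halfPow k) (prodℚ k (w ∘ suc)))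
  where open +-*-Solver

∣prodℚ∣≤halfPow : ∀ j (u : Fin j → ℚ) → (∀ t → ∣ u t ∣ ≤ℚ ½) → ∣ prodℚ j u ∣ ≤ℚ halfPow j
∣prodℚ∣≤halfPow zero    u ∣u∣≤½ = ℚ.≤-refl
∣prodℚ∣≤halfPow (suc j) u ∣u∣≤½ = subst (_≤ℚ ½ * halfPow j) (sym (ℚ.∣p*q∣≡∣p∣*∣q∣ (u zero) _))
  (*-mono-≤-nonNeg (ℚ.0≤∣p∣ (u zero)) (ℚ.<⇒≤ (halfPow-pos j)) (∣u∣≤½ zero) (∣prodℚ∣≤halfPow j (u ∘ suc) (∣u∣≤½ ∘ suc)))

scaled-bounds : ∀ ε y → 0ℚ ≤ℚ ε → ε ≤ℚ 1ℚ → - ½ ≤ℚ y → y ≤ℚ ½ → (- ½ ≤ℚ ε * y) × (ε * y ≤ℚ ½)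
scaled-bounds ε y 0≤ε ε≤1 -½≤y y≤½ = ∣p∣≤q⇒-q≤p≤q (ε * y) ½ (begin
  ∣ ε * y ∣       ≡⟨ ℚ.∣p*q∣≡∣p∣*∣q∣ ε y ⟩
  ∣ ε ∣ * ∣ y ∣   ≤⟨ *-mono-≤-nonNeg (ℚ.0≤∣p∣ ε) (ℚ.nonNegative⁻¹ ½) (subst (_≤ℚ 1ℚ) (sym (ℚ.0≤p⇒∣p∣≡p 0≤ε)) ε≤1)
                                      (-q≤p≤q⇒∣p∣≤q y ½ -½≤y y≤½) ⟩
  1ℚ * ½          ≡⟨ ℚ.*-identityˡ ½ ⟩
  ½               ∎)
  where open ℚ.≤-Reasoning

module _ {A : Set} where

  ∑-allFuns-suc : ∀ ℓ (xs : List A) (G : (Fin (suc ℓ) → A) → ℚ) →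
                  ∑ (allFuns (suc ℓ) xs) G ≡ ∑ xs (λ a → ∑ (allFuns ℓ xs) (λ g → G (a ∷ᶠ g)))
  ∑-allFuns-suc ℓ xs G = trans (∑-concatMap (λ a → map (a ∷ᶠ_) (allFuns ℓ xs)) xs G)
                               (∑-cong xs (λ a → ∑-map (a ∷ᶠ_) (allFuns ℓ xs) G))

  ∈-allFuns-suc⁻ : ∀ ℓ (xs : List A) {x : Fin (suc ℓ) → A} → x ∈ allFuns (suc ℓ) xs →
                   ∃ λ a → ∃ λ g → a ∈ xs × g ∈ allFuns ℓ xs × x ≡ a ∷ᶠ g
  ∈-allFuns-suc⁻ ℓ xs x∈ with find (∈.∈-concatMap⁻ (λ a → map (a ∷ᶠ_) (allFuns ℓ xs)) {xs = xs} x∈)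
  ... | a , a∈ , x∈map with ∈.∈-map⁻ (a ∷ᶠ_) x∈map
  ...   | g , g∈ , x≡a∷g = a , g , a∈ , g∈ , x≡a∷g

  ∈-allFuns-suc⁺ : ∀ ℓ (xs : List A) {a : A} {g : Fin ℓ → A} → a ∈ xs → g ∈ allFuns ℓ xs →
                   (a ∷ᶠ g) ∈ allFuns (suc ℓ) xs
  ∈-allFuns-suc⁺ ℓ xs a∈ g∈ = ∈.∈-concatMap⁺ (λ a → map (a ∷ᶠ_) (allFuns ℓ xs)) (Any.map (λ { refl → ∈.∈-map⁺ (_ ∷ᶠ_) g∈ }) a∈)

  allFuns-∈ : ∀ ℓ (xs : List A) {x : Fin ℓ → A} → x ∈ allFuns ℓ xs → ∀ i → x i ∈ xs
  allFuns-∈ (suc ℓ) xs x∈ i with ∈-allFuns-suc⁻ ℓ xs x∈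
  allFuns-∈ (suc ℓ) xs x∈ zero    | a , g , a∈ , g∈ , refl = a∈
  allFuns-∈ (suc ℓ) xs x∈ (suc i) | a , g , a∈ , g∈ , refl = allFuns-∈ ℓ xs g∈ i

  allFuns-complete : ∀ ℓ (xs : List A) (R : A → A → Set) (x : Fin ℓ → A) →
                     (∀ i → ∃ λ a → a ∈ xs × R a (x i)) →
                     ∃ λ x′ → x′ ∈ allFuns ℓ xs × (∀ i → R (x′ i) (x i))
  allFuns-complete zero    xs R x _ = (λ ()) , here refl , λ ()
  allFuns-complete (suc ℓ) xs R x near with near zero | allFuns-complete ℓ xs R (x ∘ suc) (near ∘ suc)
  ... | a , a∈ , Ra | g , g∈ , Rg = a ∷ᶠ g , ∈-allFuns-suc⁺ ℓ xs a∈ g∈ , λ { zero → Ra ; (suc i) → Rg i }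

TranslationInvariant : ∀ {A : Set} → (A → A → Set) → (A → A → A) → List A → Set
TranslationInvariant {A} _≈_ _⊕_ xs =
  ∀ c (G : A → ℚ) → (∀ {a b} → a ≈ b → G a ≡ G b) → ∑ xs (λ a → G (a ⊕ c)) ≡ ∑ xs G

allFuns-translationInvariant : ∀ {A : Set} {_≈_ : A → A → Set} {_⊕_ : A → A → A} → (∀ {a} → a ≈ a) →
  ∀ xs → TranslationInvariant _≈_ _⊕_ xs → ∀ ℓ → TranslationInvariant (Pointwise _≈_) (zipWith _⊕_) (allFuns ℓ xs)
allFuns-translationInvariant ≈-refl xs inv zero    z G G-resp = cong (_+ 0ℚ) (G-resp (λ ()))
allFuns-translationInvariant {_≈_ = _≈_} {_⊕_} ≈-refl xs inv (suc ℓ) z G G-resp = begin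
  ∑ (allFuns (suc ℓ) xs) (λ x → G (zipWith _⊕_ x z))
    ≡⟨ ∑-allFuns-suc ℓ xs (λ x → G (zipWith _⊕_ x z)) ⟩
  ∑ xs (λ a → ∑ (allFuns ℓ xs) (λ g → G (zipWith _⊕_ (a ∷ᶠ g) z)))
    ≡⟨ ∑-cong xs (λ a → ∑-cong (allFuns ℓ xs) (λ g → G-resp λ { zero → ≈-refl ; (suc i) → ≈-refl })) ⟩
  ∑ xs (λ a → H (a ⊕ z zero))
    ≡⟨ inv (z zero) H H-resp ⟩
  ∑ xs H
    ≡⟨ ∑-cong xs (λ a → allFuns-translationInvariant ≈-refl xs inv ℓ (z ∘ suc) (G ∘ (a ∷ᶠ_))
                          (λ g≈g′ → G-resp λ { zero → ≈-refl ; (suc i) → g≈g′ i })) ⟩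
  ∑ xs (λ a → ∑ (allFuns ℓ xs) (λ g → G (a ∷ᶠ g)))
    ≡⟨ sym (∑-allFuns-suc ℓ xs G) ⟩
  ∑ (allFuns (suc ℓ) xs) G ∎
  where
  open ≡-Reasoning
  H : _ → ℚ
  H a = ∑ (allFuns ℓ xs) (λ g → G (a ∷ᶠ zipWith _⊕_ g (z ∘ suc)))
  H-resp : ∀ {a b} → a ≈ b → H a ≡ H b
  H-resp a≈b = ∑-cong (allFuns ℓ xs) (λ g → G-resp λ { zero → a≈b ; (suc i) → ≈-refl })

𝟙-does-⇔ : ∀ {P Q : Set} (P? : Dec P) (Q? : Dec Q) → (P → Q) → (Q → P) → 𝟙 (does P?) ≡ 𝟙 (does Q?)
𝟙-does-⇔ (yes _) (yes _) _   _   = refl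
𝟙-does-⇔ (no _)  (no _)  _   _   = refl
𝟙-does-⇔ (yes p) (no ¬q) P→Q _   = ⊥-elim (¬q (P→Q p))
𝟙-does-⇔ (no ¬p) (yes q) _   Q→P = ⊥-elim (¬p (Q→P q))

𝟙-does-¬ : ∀ {P : Set} (P? : Dec P) → ¬ P → 𝟙 (does P?) ≡ 0ℚ
𝟙-does-¬ P? ¬p = cong 𝟙 (dec-false P? ¬p)

-- Definitionally equal to StrictInc 𝔽 B, for every field 𝔽.
Increasing : ∀ {k ℓ} → Vec (Fin k) ℓ → Set
Increasing {ℓ = ℓ} B = ∀ (a b : Fin ℓ) → a Fin.< b → lookup B a Fin.< lookup B b

Sub : ℕ → Set
Sub k = Σ ℕ (Vec (Fin k))

insertZero : ∀ {k} → Sub k → Sub (suc k)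
insertZero (j , B) = suc j , zero ∷ Vec.map suc B

shiftUp : ∀ {k} → Sub k → Sub (suc k)
shiftUp (j , B) = j , Vec.map suc B

subsets : (k : ℕ) → List (Sub k)
subsets zero    = (0 , []) ∷ []
subsets (suc k) = map insertZero (subsets k) ++ map shiftUp (subsets k)

∑-subsets-suc : ∀ k (T : Sub (suc k) → ℚ) →
                ∑ (subsets (suc k)) T ≡ ∑ (subsets k) (T ∘ insertZero) + ∑ (subsets k) (T ∘ shiftUp)
∑-subsets-suc k T = trans (∑-++ (map insertZero (subsets k)) (map shiftUp (subsets k)) T)
                          (cong₂ _+_ (∑-map insertZero (subsets k) T) (∑-map shiftUp (subsets k) T))

∑-subsets-const : ∀ k c → ∑ (subsets k) (λ _ → c) ≡ two ^ k * c
∑-subsets-const zero    c = trans (ℚ.+-identityʳ c) (sym (ℚ.*-identityˡ c))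
∑-subsets-const (suc k) c = begin
  ∑ (subsets (suc k)) (λ _ → c)         ≡⟨ ∑-subsets-suc k (λ _ → c) ⟩
  ∑ (subsets k) (λ _ → c) + ∑ (subsets k) (λ _ → c) ≡⟨ cong₂ _+_ (∑-subsets-const k c) (∑-subsets-const k c) ⟩
  two ^ k * c + two ^ k * c             ≡⟨ solve 2 (λ t c → t :* c :+ t :* c := ((con 1ℚ :+ con 1ℚ) :* t) :* c) refl (two ^ k) c ⟩
  two ^ suc k * c                       ∎
  where
  open ≡-Reasoning
  open +-*-Solver

∑-subsets-empty : ∀ k → ∑ (subsets k) (λ p → 𝟙 (does (proj₁ p ℕ.≟ 0))) ≡ 1ℚ
∑-subsets-empty zero    = ℚ.+-identityʳ 1ℚ
∑-subsets-empty (suc k) = begin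
  ∑ (subsets (suc k)) (λ p → 𝟙 (does (proj₁ p ℕ.≟ 0)))  ≡⟨ ∑-subsets-suc k _ ⟩
  ∑ (subsets k) (λ _ → 0ℚ) + ∑ (subsets k) (λ p → 𝟙 (does (proj₁ p ℕ.≟ 0))) ≡⟨ cong₂ _+_ (∑-zero (subsets k)) (∑-subsets-empty k) ⟩
  0ℚ + 1ℚ                                               ≡⟨ ℚ.+-identityˡ 1ℚ ⟩
  1ℚ                                                    ∎
  where open ≡-Reasoning

increasing-shiftUp : ∀ {k ℓ} (B : Vec (Fin k) ℓ) → Increasing B → Increasing (Vec.map suc B)
increasing-shiftUp B inc a b a<b
  rewrite VecP.lookup-map a Fin.suc B | VecP.lookup-map b Fin.suc B = s≤s (inc a b a<b)

increasing-insertZero : ∀ {k ℓ} (B : Vec (Fin k) ℓ) → Increasing B → Increasing {suc k} (zero ∷ Vec.map suc B)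
increasing-insertZero B inc zero    (suc b) _ rewrite VecP.lookup-map b Fin.suc B = s≤s z≤n
increasing-insertZero B inc (suc a) (suc b) (s≤s a<b) = increasing-shiftUp B inc a b a<b

subsets-increasing : ∀ k {p : Sub k} → p ∈ subsets k → Increasing (proj₂ p)
subsets-increasing zero    (here refl) ()
subsets-increasing (suc k) p∈ with ∈.∈-++⁻ (map insertZero (subsets k)) p∈
... | inj₁ p∈ins with ∈.∈-map⁻ insertZero p∈ins
...   | (j , B) , B∈ , refl = increasing-insertZero B (subsets-increasing k B∈)
subsets-increasing (suc k) p∈ | inj₂ p∈shf with ∈.∈-map⁻ shiftUp p∈shf
...   | (j , B) , B∈ , refl = increasing-shiftUp B (subsets-increasing k B∈)

key : ∀ {k} → Sub k → List (Fin k)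
key = toList ∘ proj₂

_≟ₗ_ : ∀ {k} → DecidableEquality (List (Fin k))
_≟ₗ_ = ListP.≡-dec Fin._≟_

key-insertZero : ∀ {k} (p : Sub k) → key (insertZero p) ≡ zero ∷ map suc (key p)
key-insertZero (j , B) = cong (zero ∷_) (VecP.toList-map Fin.suc B)

key-shiftUp : ∀ {k} (p : Sub k) → key (shiftUp p) ≡ map suc (key p)
key-shiftUp (j , B) = VecP.toList-map Fin.suc B

map-suc-injective : ∀ {k} {xs ys : List (Fin k)} → map suc xs ≡ map suc ys → xs ≡ ys
map-suc-injective = ListP.map-injective FinP.suc-injective

zero∷≢map-suc : ∀ {k} {xs : List (Fin (suc k))} (ys : List (Fin k)) → zero ∷ xs ≢ map suc ys
zero∷≢map-suc []       ()
zero∷≢map-suc (y ∷ ys) ()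

Increasingₗ : ∀ {k} → List (Fin k) → Set
Increasingₗ = AllPairs Fin._<_

unshift : ∀ {k} (ys : List (Fin (suc k))) → All (_≢ zero) ys → ∃ λ zs → ys ≡ map suc zs
unshift []           []              = [] , refl
unshift (zero ∷ ys)  (0≢0 ∷ _)       = ⊥-elim (0≢0 refl)
unshift (suc y ∷ ys) (_ ∷ ys≢0) with unshift ys ys≢0
... | zs , refl = y ∷ zs , refl

>⇒≢zero : ∀ {k} {a y : Fin (suc k)} → a Fin.< y → y ≢ zero
>⇒≢zero a<y refl = ℕ.n≮0 a<y

unshift-increasing : ∀ {k} {zs : List (Fin k)} → Increasingₗ (map suc zs) → Increasingₗ zs
unshift-increasing = AllPairs.map ℕ.≤-pred ∘ AllPairsP.map⁻

increasingₗ-view : ∀ {k} {ys : List (Fin (suc k))} → Increasingₗ ys →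
  ∃ λ zs → Increasingₗ zs × (ys ≡ map suc zs ⊎ ys ≡ zero ∷ map suc zs)
increasingₗ-view {ys = []}         []  = [] , [] , inj₁ refl
increasingₗ-view {ys = zero ∷ ys}  (0<ys ∷ inc) with unshift ys (All.map >⇒≢zero 0<ys)
... | zs , refl = zs , unshift-increasing inc , inj₂ refl
increasingₗ-view {ys = suc y ∷ ys} inc@(y<ys ∷ _) with unshift (suc y ∷ ys) ((λ ()) ∷ All.map >⇒≢zero y<ys)
... | zs , eq = zs , unshift-increasing (subst Increasingₗ eq inc) , inj₁ eq

∑-subsets-key : ∀ k {ys : List (Fin k)} → Increasingₗ ys → ∑ (subsets k) (λ p → 𝟙 (does (key p ≟ₗ ys))) ≡ 1ℚ
∑-subsets-key zero    {[]}     _   = ℚ.+-identityʳ 1ℚ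
∑-subsets-key zero    {() ∷ _} _
∑-subsets-key (suc k) {ys}     inc with increasingₗ-view inc
... | zs , inc′ , inj₁ refl = begin
  ∑ (subsets (suc k)) (λ p → 𝟙 (does (key p ≟ₗ ys)))            ≡⟨ ∑-subsets-suc k _ ⟩
  ∑ (subsets k) (λ p → 𝟙 (does (key (insertZero p) ≟ₗ ys))) +
  ∑ (subsets k) (λ p → 𝟙 (does (key (shiftUp p) ≟ₗ ys)))       ≡⟨ cong₂ _+_ (trans (∑-cong (subsets k) insertZero-miss) (∑-zero (subsets k)))
                                                                             (trans (∑-cong (subsets k) shiftUp-hit) (∑-subsets-key k inc′)) ⟩
  0ℚ + 1ℚ                                                         ≡⟨ ℚ.+-identityˡ 1ℚ ⟩
  1ℚ                                                              ∎
  where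
  open ≡-Reasoning
  insertZero-miss : ∀ p → 𝟙 (does (key (insertZero p) ≟ₗ ys)) ≡ 0ℚ
  insertZero-miss p = 𝟙-does-¬ (key (insertZero p) ≟ₗ ys) (λ eq → zero∷≢map-suc zs (trans (sym (key-insertZero p)) eq))
  shiftUp-hit : ∀ p → 𝟙 (does (key (shiftUp p) ≟ₗ ys)) ≡ 𝟙 (does (key p ≟ₗ zs))
  shiftUp-hit p = 𝟙-does-⇔ (key (shiftUp p) ≟ₗ ys) (key p ≟ₗ zs) (λ eq → map-suc-injective (trans (sym (key-shiftUp p)) eq))
                                                                   (λ eq → trans (key-shiftUp p) (cong (map suc) eq))
... | zs , inc′ , inj₂ refl = begin
  ∑ (subsets (suc k)) (λ p → 𝟙 (does (key p ≟ₗ ys)))            ≡⟨ ∑-subsets-suc k _ ⟩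
  ∑ (subsets k) (λ p → 𝟙 (does (key (insertZero p) ≟ₗ ys))) +
  ∑ (subsets k) (λ p → 𝟙 (does (key (shiftUp p) ≟ₗ ys)))       ≡⟨ cong₂ _+_ (trans (∑-cong (subsets k) insertZero-hit) (∑-subsets-key k inc′))
                                                                             (trans (∑-cong (subsets k) shiftUp-miss) (∑-zero (subsets k))) ⟩
  1ℚ + 0ℚ                                                         ≡⟨ ℚ.+-identityʳ 1ℚ ⟩
  1ℚ                                                              ∎
  where
  open ≡-Reasoning
  insertZero-hit : ∀ p → 𝟙 (does (key (insertZero p) ≟ₗ ys)) ≡ 𝟙 (does (key p ≟ₗ zs))
  insertZero-hit p = 𝟙-does-⇔ (key (insertZero p) ≟ₗ ys) (key p ≟ₗ zs) (λ eq → map-suc-injective (ListP.∷-injectiveʳ (trans (sym (key-insertZero p)) eq)))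
                                                                            (λ eq → trans (key-insertZero p) (cong (λ xs → zero ∷ map suc xs) eq))
  shiftUp-miss : ∀ p → 𝟙 (does (key (shiftUp p) ≟ₗ ys)) ≡ 0ℚ
  shiftUp-miss p = 𝟙-does-¬ (key (shiftUp p) ≟ₗ ys) (λ eq → zero∷≢map-suc (key p) (sym (trans (sym (key-shiftUp p)) eq)))

increasing⇒increasingₗ : ∀ {k ℓ} (B : Vec (Fin k) ℓ) → Increasing B → Increasingₗ (toList B)
increasing⇒increasingₗ []      inc = []
increasing⇒increasingₗ (x ∷ B) inc =
  all-lookup B (λ t → inc zero (suc t) (s≤s z≤n)) ∷ increasing⇒increasingₗ B (λ a b a<b → inc (suc a) (suc b) (s≤s a<b))
  where
  all-lookup : ∀ {ℓ} {P : Fin _ → Set} (B : Vec (Fin _) ℓ) → (∀ t → P (lookup B t)) → All P (toList B)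
  all-lookup []      P[B] = []
  all-lookup (y ∷ B) P[B] = P[B] zero ∷ all-lookup B (P[B] ∘ suc)

prodℚ-binomial : ∀ k (β : ℚ) (u : Fin k → ℚ) →
  prodℚ k (λ i → 1ℚ + β * u i) ≡ ∑ (subsets k) (λ p → β ^ proj₁ p * prodℚ (proj₁ p) (u ∘ lookup (proj₂ p)))
prodℚ-binomial zero    β u = sym (trans (ℚ.+-identityʳ _) (ℚ.*-identityˡ 1ℚ))
prodℚ-binomial (suc k) β u = begin
  (1ℚ + β * u zero) * prodℚ k (λ i → 1ℚ + β * u (suc i))  ≡⟨ cong ((1ℚ + β * u zero) *_) (prodℚ-binomial k β (u ∘ suc)) ⟩
  (1ℚ + β * u zero) * S                                   ≡⟨ solve 2 (λ a s → (con 1ℚ :+ a) :* s := a :* s :+ s) refl (β * u zero) S ⟩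
  (β * u zero) * S + S                                    ≡⟨ cong₂ _+_ (trans (sym (∑-*ˡ (subsets k) (β * u zero) T′))
                                                                              (∑-cong (subsets k) insertZero-term))
                                                                       (∑-cong (subsets k) shiftUp-term) ⟩
  ∑ (subsets k) (T ∘ insertZero) + ∑ (subsets k) (T ∘ shiftUp) ≡⟨ sym (∑-subsets-suc k T) ⟩
  ∑ (subsets (suc k)) T                                   ∎
  where
  open ≡-Reasoning
  open +-*-Solver
  T : Sub (suc k) → ℚ
  T (j , B) = β ^ j * prodℚ j (u ∘ lookup B)
  T′ : Sub k → ℚ
  T′ (j , B) = β ^ j * prodℚ j (u ∘ suc ∘ lookup B)
  S : ℚ
  S = ∑ (subsets k) T′
  u∘lookup-shift : ∀ {j} (B : Vec (Fin k) j) → prodℚ j (u ∘ suc ∘ lookup B) ≡ prodℚ j (u ∘ lookup (Vec.map suc B))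
  u∘lookup-shift {j} B = prodℚ-cong j (λ t → cong u (sym (VecP.lookup-map t Fin.suc B)))
  shiftUp-term : ∀ p → T′ p ≡ T (shiftUp p)
  shiftUp-term (j , B) = cong (β ^ j *_) (u∘lookup-shift B)
  insertZero-term : ∀ p → (β * u zero) * T′ p ≡ T (insertZero p)
  insertZero-term (j , B) = trans (solve 4 (λ b u0 w P → (b :* u0) :* (w :* P) := (b :* w) :* (u0 :* P)) refl β (u zero) (β ^ j) _)
                                  (cong (λ v → (β * β ^ j) * (u zero * v)) (u∘lookup-shift B))

∑ℕ : ∀ k → (Fin k → ℕ) → ℕ
∑ℕ _ = ℕSum.sum

bit : Bool → ℕ
bit true  = 1
bit false = 0

∑ℕ-mono-≤ : ∀ k {g h : Fin k → ℕ} → (∀ i → g i ≤ h i) → ∑ℕ k g ≤ ∑ℕ k h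
∑ℕ-mono-≤ zero    g≤h = z≤n
∑ℕ-mono-≤ (suc k) g≤h = ℕ.+-mono-≤ (g≤h zero) (∑ℕ-mono-≤ k (g≤h ∘ suc))

∑ℕ-term : ∀ k (g : Fin k → ℕ) t → g t ≤ ∑ℕ k g
∑ℕ-term (suc k) g zero    = ℕ.m≤m+n (g zero) _
∑ℕ-term (suc k) g (suc t) = ℕ.≤-trans (∑ℕ-term k (g ∘ suc) t) (ℕ.m≤n+m _ (g zero))

∑ℕ-ones : ∀ j → ∑ℕ j (λ _ → 1) ≡ j
∑ℕ-ones zero    = refl
∑ℕ-ones (suc j) = cong suc (∑ℕ-ones j)

∑ℕ-δ : ∀ k (b : Fin k) → ∑ℕ k (λ i → bit (does (b Fin.≟ i))) ≡ 1
∑ℕ-δ (suc k) zero    = cong suc (ℕSum.sum-replicate-zero k)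
∑ℕ-δ (suc k) (suc b) = ∑ℕ-δ k b

length-filter-tabulate : ∀ {X : Set} {P : X → Set} k (g : Fin k → X) (P? : ∀ x → Dec (P x)) →
  length (filter P? (toList (Vec.tabulate g))) ≡ ∑ℕ k (λ i → bit (does (P? (g i))))
length-filter-tabulate zero    g P? = refl
length-filter-tabulate (suc k) g P? with does (P? (g zero))
... | true  = cong suc (length-filter-tabulate k (g ∘ suc) P?)
... | false = length-filter-tabulate k (g ∘ suc) P?

allL-tabulate⁻ : ∀ {X : Set} n (g : Fin n → X) (p : X → Bool) → allL p (toList (Vec.tabulate g)) ≡ true → ∀ i → p (g i) ≡ true
allL-tabulate⁻ (suc n) g p all≡true i with p (g zero) in p[g₀]
allL-tabulate⁻ (suc n) g p all≡true zero    | true = p[g₀]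
allL-tabulate⁻ (suc n) g p all≡true (suc i) | true = allL-tabulate⁻ n (g ∘ suc) p all≡true i
allL-tabulate⁻ (suc n) g p ()       i       | false

allL-tabulate⁺ : ∀ {X : Set} n (g : Fin n → X) (p : X → Bool) → (∀ i → p (g i) ≡ true) → allL p (toList (Vec.tabulate g)) ≡ true
allL-tabulate⁺ zero    g p _     = refl
allL-tabulate⁺ (suc n) g p p[g] rewrite p[g] zero = allL-tabulate⁺ n (g ∘ suc) p (p[g] ∘ suc)

allL-tabulate-cong : ∀ {X : Set} n (g : Fin n → X) (p p′ : X → Bool) → (∀ i → p (g i) ≡ p′ (g i)) →
                     allL p (toList (Vec.tabulate g)) ≡ allL p′ (toList (Vec.tabulate g))
allL-tabulate-cong zero    g p p′ _  = refl
allL-tabulate-cong (suc n) g p p′ p≡p′ rewrite p≡p′ zero =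
  cong (if p′ (g zero) then_else false) (allL-tabulate-cong n (g ∘ suc) p p′ (p≡p′ ∘ suc))

⌊⌋≡true⇒ : ∀ {A : Set} (a? : Dec A) → ⌊ a? ⌋ ≡ true → A
⌊⌋≡true⇒ (yes a) _ = a

⌊⌋≡true⇐ : ∀ {A : Set} (a? : Dec A) → A → ⌊ a? ⌋ ≡ true
⌊⌋≡true⇐ (yes _) _ = refl
⌊⌋≡true⇐ (no ¬a) a = ⊥-elim (¬a a)

increasing-injective : ∀ {k j} (B : Vec (Fin k) j) → Increasing B → ∀ a b → lookup B a ≡ lookup B b → a ≡ b
increasing-injective B inc a b B[a]≡B[b] with FinP.<-cmp a b
... | tri< a<b _ _ = ⊥-elim (ℕ.<-irrefl (cong Fin.toℕ B[a]≡B[b]) (inc a b a<b))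
... | tri≈ _ a≡b _ = a≡b
... | tri> _ _ b<a = ⊥-elim (ℕ.<-irrefl (cong Fin.toℕ (sym B[a]≡B[b])) (inc b a b<a))

isEven-suc : ∀ s → isEven s ≡ false → isEven (suc s) ≡ true
isEven-suc (suc zero)    _   = refl
isEven-suc (suc (suc s)) odd = isEven-suc s odd

cOf-even : ∀ s → isEven (cOf s) ≡ true
cOf-even s with isEven s in parity
... | true  = parity
... | false = isEven-suc s parity

s≤cOf : ∀ s → s ≤ cOf s
s≤cOf s with isEven s
... | true  = ℕ.≤-refl
... | false = ℕ.n≤1+n s

even<cOf⇒<s : ∀ s j → isEven j ≡ true → j < cOf s → j < s
even<cOf⇒<s s j even j<c with isEven s in parity
... | true  = j<c
... | false with ℕ.m≤n⇒m<n∨m≡n (ℕ.≤-pred j<c)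
...   | inj₁ j<s  = j<s
...   | inj₂ refl with () ← trans (sym even) parity

module _ {A X : Set} (_≟_ : DecidableEquality X) (key : A → X) (V : A → ℚ) where

  ∑-select-∉ : ∀ xs x → ¬ x ∈ map key xs → ∑ xs (λ a → 𝟙 (does (x ≟ key a)) * V a) ≡ 0ℚ
  ∑-select-∉ xs x x∉ = trans (∑-cong-∈ xs miss) (∑-zero xs)
    where
    miss : ∀ a → a ∈ xs → 𝟙 (does (x ≟ key a)) * V a ≡ 0ℚ
    miss a a∈ = trans (cong (_* V a) (𝟙-does-¬ (x ≟ key a) (λ x≡ → x∉ (subst (_∈ map key xs) (sym x≡) (∈.∈-map⁺ key a∈)))))
                      (ℚ.*-zeroˡ (V a))

  ∑-select : ∀ xs x → Unique (map key xs) → x ∈ map key xs →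
             ∃ λ a → a ∈ xs × key a ≡ x × ∑ xs (λ a → 𝟙 (does (x ≟ key a)) * V a) ≡ V a
  ∑-select (a ∷ xs) x (a∉xs ∷ unique) (here refl) = a , here refl , refl , (begin
    𝟙 (does (key a ≟ key a)) * V a + ∑ xs (λ a′ → 𝟙 (does (key a ≟ key a′)) * V a′)
      ≡⟨ cong₂ _+_ (cong (λ b → 𝟙 b * V a) (dec-true (key a ≟ key a) refl)) (∑-select-∉ xs (key a) (All¬⇒¬Any a∉xs)) ⟩
    1ℚ * V a + 0ℚ
      ≡⟨ trans (ℚ.+-identityʳ _) (ℚ.*-identityˡ (V a)) ⟩
    V a ∎)
    where open ≡-Reasoning
  ∑-select (a ∷ xs) x (a∉xs ∷ unique) (there x∈) with ∑-select xs x unique x∈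
  ... | a′ , a′∈ , refl , ∑≡Va′ = a′ , there a′∈ , refl , (begin
    𝟙 (does (key a′ ≟ key a)) * V a + ∑ xs (λ a″ → 𝟙 (does (key a′ ≟ key a″)) * V a″)
      ≡⟨ cong₂ _+_ (trans (cong (_* V a) (𝟙-does-¬ (key a′ ≟ key a) (All.lookup a∉xs x∈ ∘ sym))) (ℚ.*-zeroˡ (V a))) ∑≡Va′ ⟩
    0ℚ + V a′
      ≡⟨ ℚ.+-identityˡ (V a′) ⟩
    V a′ ∎)
    where open ≡-Reasoning

toList-injective : ∀ {A : Set} {c} (B B′ : Vec A c) → toList B ≡ toList B′ → B ≡ B′
toList-injective B B′ eq = trans (sym (VecP.cast-is-id refl B)) (VecP.toList-injective refl B B′ eq)

ε₀ : ℚ → ℕ → ℚ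
ε₀ A k = 1ℚ ⊓ (- A * halfPow (suc k))

ε₀≤1 : ∀ A k → ε₀ A k ≤ℚ 1ℚ
ε₀≤1 A k = ℚ.p⊓q≤p 1ℚ (- A * halfPow (suc k))

ε₀-pos : ∀ A k → A <ℚ 0ℚ → 0ℚ <ℚ ε₀ A k
ε₀-pos A k A<0 with ℚ.⊓-sel 1ℚ (- A * halfPow (suc k))
... | inj₁ ε≡1   = subst (0ℚ <ℚ_) (sym ε≡1) (ℚ.positive⁻¹ 1ℚ)
... | inj₂ ε≡-Ah = subst (0ℚ <ℚ_) (sym ε≡-Ah) (ℚ.positive⁻¹ (- A * halfPow (suc k))
  {{ℚ.pos*pos⇒pos (- A) {{ℚ.positive (ℚ.neg-antimono-< A<0)}} (halfPow (suc k)) {{ℚ.positive (halfPow-pos (suc k))}}}})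

ε₀-small : ∀ A c k → A <ℚ 0ℚ → (ε₀ A k + ε₀ A k) ^ c * A + two ^ k * ε₀ A k ^ suc c <ℚ 0ℚ
ε₀-small A c k A<0 = begin-strict
  (ε + ε) ^ c * A + two ^ k * ε ^ suc c     ≡⟨ cong (λ x → x * A + two ^ k * ε ^ suc c) ([x+x]^≡two^*x^ ε c) ⟩
  two ^ c * ε ^ c * A + two ^ k * (ε * ε ^ c) ≡⟨ solve 5 (λ t a e p T → t :* p :* a :+ T :* (e :* p) := p :* (t :* a :+ T :* e)) refl (two ^ c) A ε (ε ^ c) (two ^ k) ⟩
  ε ^ c * (two ^ c * A + two ^ k * ε)       <⟨ ℚ.*-monoʳ-<-pos (ε ^ c) {{ℚ.positive (^-pos c (ε₀-pos A k A<0))}} inner<0 ⟩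
  ε ^ c * 0ℚ                                ≡⟨ ℚ.*-zeroʳ (ε ^ c) ⟩
  0ℚ                                        ∎
  where
  open ℚ.≤-Reasoning
  open +-*-Solver
  -A h ε : ℚ
  -A = - A
  h = halfPow (suc k)
  ε = ε₀ A k
  two^c*A≤A : two ^ c * A ≤ℚ A
  two^c*A≤A = subst (two ^ c * A ≤ℚ_) (ℚ.*-identityˡ A) (ℚ.*-monoʳ-≤-nonPos A {{ℚ.nonPositive (ℚ.<⇒≤ A<0)}} (1≤two^ c))
  two^k*ε≤-A/2 : two ^ k * ε ≤ℚ -A * ½
  two^k*ε≤-A/2 = begin
    two ^ k * ε          ≤⟨ ℚ.*-monoˡ-≤-nonNeg (two ^ k) {{ℚ.nonNegative (ℚ.<⇒≤ (^-pos k 0<two))}} (ℚ.p⊓q≤q 1ℚ (-A * h)) ⟩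
    two ^ k * (-A * h)   ≡⟨ solve 3 (λ t a h → t :* (a :* h) := a :* (t :* h)) refl (two ^ k) -A h ⟩
    -A * (two ^ k * h)   ≡⟨ cong (-A *_) (two^*halfPow-suc k) ⟩
    -A * ½               ∎
  inner<0 : two ^ c * A + two ^ k * ε <ℚ 0ℚ
  inner<0 = begin-strict
    two ^ c * A + two ^ k * ε   ≤⟨ ℚ.+-mono-≤ two^c*A≤A two^k*ε≤-A/2 ⟩
    A + -A * ½                  ≡⟨ solve 1 (λ a → a :+ (:- a) :* con ½ := a :* con ½) refl A ⟩
    A * ½                       <⟨ ℚ.*-monoˡ-<-pos ½ A<0 ⟩
    0ℚ * ½                      ≡⟨ ℚ.*-zeroˡ ½ ⟩
    0ℚ                          ∎

module FieldSums {q : ℕ} (𝔽 : FiniteField q) where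
  open FiniteField 𝔽

  commutativeRing : CommutativeRing _ _
  commutativeRing = record { isCommutativeRing = isCommutativeRing }

  open CommutativeRing commutativeRing public
    using (+-assoc; +-comm; +-identityˡ; +-identityʳ; -‿inverseˡ; -‿inverseʳ;
           *-assoc; *-comm; *-identityˡ; *-identityʳ; distribˡ; distribʳ; zeroˡ; zeroʳ)
  open import Algebra.Properties.Ring (CommutativeRing.ring commutativeRing) public
    using (-‿distribˡ-*; -‿distribʳ-*; +-inverseʳ-unique; -0#≈0#; -‿+-comm; xyx⁻¹≈y)
  open import Algebra.Properties.CommutativeSemigroup (CommutativeRing.+-commutativeSemigroup commutativeRing) public
    using (interchange)

  *-cancelˡ-nonZero : ∀ a b → a ≢ 0F → a *F b ≡ 0F → b ≡ 0F
  *-cancelˡ-nonZero a b a≢0 ab≡0 with inverse a a≢0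
  ... | a⁻¹ , aa⁻¹≡1 = begin
    b                 ≡⟨ sym (*-identityˡ b) ⟩
    1F *F b           ≡⟨ cong (_*F b) (sym (trans (*-comm a⁻¹ a) aa⁻¹≡1)) ⟩
    (a⁻¹ *F a) *F b   ≡⟨ *-assoc a⁻¹ a b ⟩
    a⁻¹ *F (a *F b)   ≡⟨ cong (a⁻¹ *F_) ab≡0 ⟩
    a⁻¹ *F 0F         ≡⟨ zeroʳ a⁻¹ ⟩
    0F                ∎
    where open ≡-Reasoning

  ∑ᶠ : (ℓ : ℕ) → (Fin ℓ → F 𝔽) → F 𝔽
  ∑ᶠ = ΣF 𝔽

  ∑ᶠ-cong : ∀ ℓ {g h : Fin ℓ → F 𝔽} → (∀ i → g i ≡ h i) → ∑ᶠ ℓ g ≡ ∑ᶠ ℓ h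
  ∑ᶠ-cong zero    g≡h = refl
  ∑ᶠ-cong (suc ℓ) g≡h = cong₂ _+F_ (g≡h zero) (∑ᶠ-cong ℓ (g≡h ∘ suc))

  ∑ᶠ-zero : ∀ ℓ → ∑ᶠ ℓ (λ _ → 0F) ≡ 0F
  ∑ᶠ-zero zero    = refl
  ∑ᶠ-zero (suc ℓ) = trans (cong (0F +F_) (∑ᶠ-zero ℓ)) (+-identityˡ 0F)

  ∑ᶠ-distrib-+ : ∀ ℓ (g h : Fin ℓ → F 𝔽) → ∑ᶠ ℓ (λ i → g i +F h i) ≡ ∑ᶠ ℓ g +F ∑ᶠ ℓ h
  ∑ᶠ-distrib-+ zero    g h = sym (+-identityˡ 0F)
  ∑ᶠ-distrib-+ (suc ℓ) g h = trans (cong ((g zero +F h zero) +F_) (∑ᶠ-distrib-+ ℓ (g ∘ suc) (h ∘ suc))) (interchange _ _ _ _)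

  ∑ᶠ-*ˡ : ∀ ℓ (c : F 𝔽) (g : Fin ℓ → F 𝔽) → ∑ᶠ ℓ (λ i → c *F g i) ≡ c *F ∑ᶠ ℓ g
  ∑ᶠ-*ˡ zero    c g = sym (zeroʳ c)
  ∑ᶠ-*ˡ (suc ℓ) c g = trans (cong ((c *F g zero) +F_) (∑ᶠ-*ˡ ℓ c (g ∘ suc))) (sym (distribˡ c _ _))

  ∑ᶠ-*ʳ : ∀ ℓ (c : F 𝔽) (g : Fin ℓ → F 𝔽) → ∑ᶠ ℓ (λ i → g i *F c) ≡ ∑ᶠ ℓ g *F c
  ∑ᶠ-*ʳ ℓ c g = trans (∑ᶠ-cong ℓ (λ i → *-comm (g i) c)) (trans (∑ᶠ-*ˡ ℓ c g) (*-comm c _))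

  ∑ᶠ-neg : ∀ ℓ (g : Fin ℓ → F 𝔽) → ∑ᶠ ℓ (λ i → -F g i) ≡ -F ∑ᶠ ℓ g
  ∑ᶠ-neg zero    g = sym -0#≈0#
  ∑ᶠ-neg (suc ℓ) g = trans (cong ((-F g zero) +F_) (∑ᶠ-neg ℓ (g ∘ suc))) (-‿+-comm _ _)

  ∑ᶠ-comm : ∀ r ℓ (h : Fin r → Fin ℓ → F 𝔽) → ∑ᶠ r (λ i → ∑ᶠ ℓ (h i)) ≡ ∑ᶠ ℓ (λ j → ∑ᶠ r (λ i → h i j))
  ∑ᶠ-comm zero    ℓ h = sym (∑ᶠ-zero ℓ)
  ∑ᶠ-comm (suc r) ℓ h = trans (cong (∑ᶠ ℓ (h zero) +F_) (∑ᶠ-comm r ℓ (h ∘ suc)))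
                             (sym (∑ᶠ-distrib-+ ℓ (h zero) (λ j → ∑ᶠ r (λ i → h (suc i) j))))

  ∑ᶠ-↑ : ∀ m ℓ (g : Fin (m ℕ.+ ℓ) → F 𝔽) → ∑ᶠ (m ℕ.+ ℓ) g ≡ ∑ᶠ m (λ i → g (i ↑ˡ ℓ)) +F ∑ᶠ ℓ (λ t → g (m ↑ʳ t))
  ∑ᶠ-↑ zero    ℓ g = sym (+-identityˡ _)
  ∑ᶠ-↑ (suc m) ℓ g = trans (cong (g zero +F_) (∑ᶠ-↑ m ℓ (g ∘ suc))) (sym (+-assoc _ _ _))

  ∑ᶠ-*-∑ᶠ : ∀ ℓ k (d : Fin ℓ → F 𝔽) (D : Fin ℓ → Fin k → F 𝔽) (x : Fin k → F 𝔽) →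
          ∑ᶠ ℓ (λ t → d t *F ∑ᶠ k (λ j → D t j *F x j)) ≡ ∑ᶠ k (λ j → ∑ᶠ ℓ (λ t → d t *F D t j) *F x j)
  ∑ᶠ-*-∑ᶠ ℓ k d D x = begin
    ∑ᶠ ℓ (λ t → d t *F ∑ᶠ k (λ j → D t j *F x j))       ≡⟨ ∑ᶠ-cong ℓ (λ t → sym (∑ᶠ-*ˡ k (d t) _)) ⟩
    ∑ᶠ ℓ (λ t → ∑ᶠ k (λ j → d t *F (D t j *F x j)))     ≡⟨ ∑ᶠ-comm ℓ k _ ⟩
    ∑ᶠ k (λ j → ∑ᶠ ℓ (λ t → d t *F (D t j *F x j)))     ≡⟨ ∑ᶠ-cong k (λ j → trans (∑ᶠ-cong ℓ (λ t → sym (*-assoc (d t) (D t j) (x j))))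
                                                                                (∑ᶠ-*ʳ ℓ (x j) _)) ⟩
    ∑ᶠ k (λ j → ∑ᶠ ℓ (λ t → d t *F D t j) *F x j)       ∎
    where open ≡-Reasoning

  δ : ∀ {r} → Fin r → Fin r → F 𝔽
  δ zero    zero    = 1F
  δ zero    (suc _) = 0F
  δ (suc _) zero    = 0F
  δ (suc p) (suc i) = δ p i

  δ-diag : ∀ {r} (p : Fin r) → δ p p ≡ 1F
  δ-diag zero    = refl
  δ-diag (suc p) = δ-diag p

  δ-offDiag : ∀ {r} (p i : Fin r) → p ≢ i → δ p i ≡ 0F
  δ-offDiag zero    zero    p≢i = ⊥-elim (p≢i refl)
  δ-offDiag zero    (suc i) _   = refl
  δ-offDiag (suc p) zero    _   = refl
  δ-offDiag (suc p) (suc i) p≢i = δ-offDiag p i (p≢i ∘ cong suc)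

  δ-sym : ∀ {r} (p i : Fin r) → δ p i ≡ δ i p
  δ-sym zero    zero    = refl
  δ-sym zero    (suc i) = refl
  δ-sym (suc p) zero    = refl
  δ-sym (suc p) (suc i) = δ-sym p i

  ∑ᶠ-δ : ∀ r (p : Fin r) (g : Fin r → F 𝔽) → ∑ᶠ r (λ i → δ p i *F g i) ≡ g p
  ∑ᶠ-δ (suc r) zero    g = trans (cong₂ _+F_ (*-identityˡ (g zero)) (trans (∑ᶠ-cong r (λ i → zeroˡ _)) (∑ᶠ-zero r))) (+-identityʳ _)
  ∑ᶠ-δ (suc r) (suc p) g = trans (cong₂ _+F_ (zeroˡ (g zero)) (∑ᶠ-δ r p (g ∘ suc))) (+-identityˡ _)

  ∑ᶠ-δʳ : ∀ r (p : Fin r) (g : Fin r → F 𝔽) → ∑ᶠ r (λ i → g i *F δ i p) ≡ g p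
  ∑ᶠ-δʳ r p g = trans (∑ᶠ-cong r (λ i → trans (*-comm (g i) (δ i p)) (cong (_*F g i) (δ-sym i p)))) (∑ᶠ-δ r p g)

module Fredholm {q : ℕ} (𝔽 : FiniteField q) where
  open FiniteField 𝔽
  open FieldSums 𝔽

  Matrix : ℕ → ℕ → Set
  Matrix r N = Fin r → Fin N → F 𝔽

  Solution : ∀ {r N} → Matrix r N → (Fin r → F 𝔽) → (Fin N → F 𝔽) → Set
  Solution {N = N} A b x = ∀ i → ∑ᶠ N (λ j → A i j *F x j) ≡ b i

  Obstruction : ∀ {r N} → Matrix r N → (Fin r → F 𝔽) → (Fin r → F 𝔽) → Set
  Obstruction {r} {N} A b z = (∀ j → ∑ᶠ r (λ i → z i *F A i j) ≡ 0F) × ∑ᶠ r (λ i → z i *F b i) ≢ 0F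

  SolvableOrObstructed : ∀ {r N} → Matrix r N → (Fin r → F 𝔽) → Set
  SolvableOrObstructed A b = ∃ (Solution A b) ⊎ ∃ (Obstruction A b)

  no-unknowns : ∀ {r} (A : Matrix r 0) b → SolvableOrObstructed A b
  no-unknowns {r} A b with FinP.any? (λ i → ¬? (b i ≟ᶠ 0F))
  ... | yes (i , bᵢ≢0) = inj₂ (δ i , (λ ()) , λ eq → bᵢ≢0 (trans (sym (∑ᶠ-δ r i b)) eq))
  ... | no  b≡0        = inj₁ ((λ ()) , λ i → sym (decidable-stable (b i ≟ᶠ 0F) (λ bᵢ≢0 → b≡0 (i , bᵢ≢0))))

  zero-column : ∀ {r N} (A : Matrix r (suc N)) b → (∀ i → A i zero ≡ 0F) →
                SolvableOrObstructed (λ i j → A i (suc j)) b → SolvableOrObstructed A b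
  zero-column {r} {N} A b A₀≡0 (inj₁ (x , Ax≡b)) = inj₁ (0F ∷ᶠ x , λ i →
    trans (cong (_+F ∑ᶠ N (λ j → A i (suc j) *F x j)) (zeroʳ (A i zero))) (trans (+-identityˡ _) (Ax≡b i)))
  zero-column {r} A b A₀≡0 (inj₂ (z , zA≡0 , zb≢0)) = inj₂ (z , zA′≡0 , zb≢0)
    where
    zA′≡0 : ∀ j → ∑ᶠ r (λ i → z i *F A i j) ≡ 0F
    zA′≡0 zero    = trans (∑ᶠ-cong r (λ i → trans (cong (z i *F_) (A₀≡0 i)) (zeroʳ _))) (∑ᶠ-zero r)
    zA′≡0 (suc j) = zA≡0 j

  module Pivot {r N} (A : Matrix r (suc N)) (b : Fin r → F 𝔽) (p : Fin r) (a⁻¹ : F 𝔽) (aa⁻¹≡1 : A p zero *F a⁻¹ ≡ 1F) where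

    μ : Fin r → F 𝔽
    μ i = A i zero *F a⁻¹

    A′ : Matrix r N
    A′ i j = A i (suc j) +F (-F (μ i *F A p (suc j)))

    b′ : Fin r → F 𝔽
    b′ i = b i +F (-F (μ i *F b p))

    μ*pivot : ∀ i → μ i *F A p zero ≡ A i zero
    μ*pivot i = trans (*-assoc _ _ _) (trans (cong (A i zero *F_) (trans (*-comm a⁻¹ _) aa⁻¹≡1)) (*-identityʳ _))

    ∑-eliminated : ∀ {ℓ} (w : Fin ℓ → F 𝔽) (u : Fin ℓ → F 𝔽) (v : F 𝔽) (c : Fin ℓ → F 𝔽) →
      ∑ᶠ ℓ (λ i → w i *F (u i +F (-F (c i *F v)))) ≡ ∑ᶠ ℓ (λ i → w i *F u i) +F ((-F ∑ᶠ ℓ (λ i → w i *F c i)) *F v)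
    ∑-eliminated {ℓ} w u v c =
      trans (∑ᶠ-cong ℓ (λ i → distribˡ (w i) (u i) _))
      (trans (∑ᶠ-distrib-+ ℓ _ _) (cong (∑ᶠ ℓ (λ i → w i *F u i) +F_)
        (trans (∑ᶠ-cong ℓ (λ i → trans (sym (-‿distribʳ-* (w i) _)) (cong -F_ (sym (*-assoc (w i) (c i) v)))))
        (trans (∑ᶠ-neg ℓ _) (trans (cong -F_ (∑ᶠ-*ʳ ℓ v _)) (-‿distribˡ-* _ v))))))

    solution : ∃ (Solution A′ b′) → ∃ (Solution A b)
    solution (x , A′x≡b′) = x₀ ∷ᶠ x , row
      where
      S : Fin r → F 𝔽
      S i = ∑ᶠ N (λ j → A i (suc j) *F x j)
      x₀ : F 𝔽
      x₀ = a⁻¹ *F (b p +F (-F S p))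
      S-eliminated : ∀ i → S i +F (-F (μ i *F S p)) ≡ b′ i
      S-eliminated i = trans (sym eq) (A′x≡b′ i)
        where
        eq : ∑ᶠ N (λ j → A′ i j *F x j) ≡ S i +F (-F (μ i *F S p))
        eq = trans (∑ᶠ-cong N (λ j → distribʳ (x j) _ _)) (trans (∑ᶠ-distrib-+ N _ _) (cong (S i +F_)
               (trans (∑ᶠ-cong N (λ j → trans (sym (-‿distribˡ-* _ (x j))) (cong -F_ (*-assoc (μ i) _ _))))
               (trans (∑ᶠ-neg N _) (cong -F_ (∑ᶠ-*ˡ N (μ i) _))))))
      row : ∀ i → (A i zero *F x₀) +F S i ≡ b i
      row i = begin
        (A i zero *F x₀) +F S i                             ≡⟨ cong (_+F S i) (sym (*-assoc (A i zero) a⁻¹ _)) ⟩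
        (μ i *F (b p +F (-F S p))) +F S i                   ≡⟨ cong (_+F S i) (trans (distribˡ (μ i) (b p) (-F S p))
                                                                                        (cong ((μ i *F b p) +F_) (sym (-‿distribʳ-* (μ i) (S p))))) ⟩
        ((μ i *F b p) +F (-F (μ i *F S p))) +F S i          ≡⟨ +-assoc _ _ _ ⟩
        (μ i *F b p) +F ((-F (μ i *F S p)) +F S i)          ≡⟨ cong ((μ i *F b p) +F_) (trans (+-comm _ _) (S-eliminated i)) ⟩
        (μ i *F b p) +F (b i +F (-F (μ i *F b p)))          ≡⟨ trans (sym (+-assoc _ _ _)) (xyx⁻¹≈y _ _) ⟩
        b i                                                 ∎
        where open ≡-Reasoning

    obstruction : ∃ (Obstruction A′ b′) → ∃ (Obstruction A b)
    obstruction (z′ , z′A′≡0 , z′b′≢0) = z , zA≡0 , zb≢0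
      where
      w = -F ∑ᶠ r (λ i → z′ i *F μ i)
      z : Fin r → F 𝔽
      z i = z′ i +F (w *F δ p i)
      ∑-corrected : ∀ (u : Fin r → F 𝔽) → ∑ᶠ r (λ i → z i *F u i) ≡ ∑ᶠ r (λ i → z′ i *F u i) +F (w *F u p)
      ∑-corrected u =
        trans (∑ᶠ-cong r (λ i → distribʳ (u i) (z′ i) _))
        (trans (∑ᶠ-distrib-+ r _ _) (cong (∑ᶠ r (λ i → z′ i *F u i) +F_)
          (trans (∑ᶠ-cong r (λ i → *-assoc w (δ p i) (u i))) (trans (∑ᶠ-*ˡ r w _) (cong (w *F_) (∑ᶠ-δ r p u))))))
      zA≡0 : ∀ j → ∑ᶠ r (λ i → z i *F A i j) ≡ 0F
      zA≡0 zero    = trans (∑-corrected (λ i → A i zero))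
        (trans (cong (_+F (w *F A p zero)) (trans (∑ᶠ-cong r (λ i → trans (cong (z′ i *F_) (sym (μ*pivot i))) (sym (*-assoc _ _ _)))) (∑ᶠ-*ʳ r _ _)))
        (trans (cong ((∑ᶠ r (λ i → z′ i *F μ i) *F A p zero) +F_) (sym (-‿distribˡ-* _ _))) (-‿inverseʳ _)))
      zA≡0 (suc j) = trans (∑-corrected (λ i → A i (suc j))) (trans (sym (∑-eliminated z′ (λ i → A i (suc j)) (A p (suc j)) μ)) (z′A′≡0 j))
      zb≢0 : ∑ᶠ r (λ i → z i *F b i) ≢ 0F
      zb≢0 zb≡0 = z′b′≢0 (trans (∑-eliminated z′ b (b p) μ) (trans (sym (∑-corrected b)) zb≡0))

    eliminate : SolvableOrObstructed A′ b′ → SolvableOrObstructed A b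
    eliminate = Sum.map solution obstruction

  fredholm : ∀ r N (A : Matrix r N) b → SolvableOrObstructed A b
  fredholm r zero    A b = no-unknowns A b
  fredholm r (suc N) A b with FinP.any? (λ i → ¬? (A i zero ≟ᶠ 0F))
  ... | no  A₀≡0       = zero-column A b (λ i → decidable-stable (A i zero ≟ᶠ 0F) (λ a≢0 → A₀≡0 (i , a≢0)))
                                     (fredholm r N (λ i j → A i (suc j)) b)
  ... | yes (p , a≢0) with inverse (A p zero) a≢0
  ...   | a⁻¹ , aa⁻¹≡1 = Pivot.eliminate A b p a⁻¹ aa⁻¹≡1 (fredholm r N (Pivot.A′ A b p a⁻¹ aa⁻¹≡1) (Pivot.b′ A b p a⁻¹ aa⁻¹≡1))

module InducedEquations {q : ℕ} (𝔽 : FiniteField q) where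
  open FiniteField 𝔽
  open FieldSums 𝔽
  open Fredholm 𝔽 using (fredholm)

  row : ∀ {ℓ} → (Fin ℓ → F 𝔽) → Sys 𝔽 1 ℓ
  row d _ = d

  _·_ : ∀ {ℓ} → (Fin ℓ → F 𝔽) → (Fin ℓ → F 𝔽) → F 𝔽
  _·_ {ℓ} d y = ∑ᶠ ℓ (λ t → d t *F y t)

  Extends : ∀ {k ℓ} → Vec (Fin k) ℓ → (Fin k → F 𝔽) → (Fin ℓ → F 𝔽) → Set
  Extends B x y = ∀ t → x (lookup B t) ≡ y t

  -- The system L x = 0, x_{B_t} = y_t as a single matrix equation.
  module Stacked {m k ℓ} (L : Sys 𝔽 m k) (B : Vec (Fin k) ℓ) (y : Fin ℓ → F 𝔽) where
    D : Fin ℓ → Fin k → F 𝔽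
    D t = δ (lookup B t)

    A : Fin (m ℕ.+ ℓ) → Fin k → F 𝔽
    A = Sum.[ L , D ]′ ∘ splitAt m

    rhs : Fin (m ℕ.+ ℓ) → F 𝔽
    rhs = Sum.[ (λ _ → 0F) , y ]′ ∘ splitAt m

    A-↑ˡ : ∀ i j → A (i ↑ˡ ℓ) j ≡ L i j
    A-↑ˡ i j = cong (λ s → Sum.[ L , D ]′ s j) (FinP.splitAt-↑ˡ m i ℓ)

    A-↑ʳ : ∀ t j → A (m ↑ʳ t) j ≡ D t j
    A-↑ʳ t j = cong (λ s → Sum.[ L , D ]′ s j) (FinP.splitAt-↑ʳ m ℓ t)

    rhs-↑ˡ : ∀ i → rhs (i ↑ˡ ℓ) ≡ 0F
    rhs-↑ˡ i = cong Sum.[ (λ _ → 0F) , y ]′ (FinP.splitAt-↑ˡ m i ℓ)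

    rhs-↑ʳ : ∀ t → rhs (m ↑ʳ t) ≡ y t
    rhs-↑ʳ t = cong Sum.[ (λ _ → 0F) , y ]′ (FinP.splitAt-↑ʳ m ℓ t)

    extension : ∀ x → Fredholm.Solution 𝔽 A rhs x → Kills 𝔽 L x × Extends B x y
    extension x Ax≡rhs = kills , extends
      where
      kills : Kills 𝔽 L x
      kills i = trans (∑ᶠ-cong k (λ j → cong (_*F x j) (sym (A-↑ˡ i j)))) (trans (Ax≡rhs (i ↑ˡ ℓ)) (rhs-↑ˡ i))
      extends : Extends B x y
      extends t = trans (sym (∑ᶠ-δ k (lookup B t) x))
                    (trans (∑ᶠ-cong k (λ j → cong (_*F x j) (sym (A-↑ʳ t j)))) (trans (Ax≡rhs (m ↑ʳ t)) (rhs-↑ʳ t)))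

    separation : ∀ z → Fredholm.Obstruction 𝔽 A rhs z → Induces 𝔽 L B (row (z ∘ (m ↑ʳ_))) × (z ∘ (m ↑ʳ_)) · y ≢ 0F
    separation z (zA≡0 , z·rhs≢0) = induced , d·y≢0
      where
      d : Fin ℓ → F 𝔽
      d = z ∘ (m ↑ʳ_)
      zL : Fin m → F 𝔽
      zL = z ∘ (_↑ˡ ℓ)
      zL*L+d*D≡0 : ∀ j → ∑ᶠ m (λ i → zL i *F L i j) +F ∑ᶠ ℓ (λ t → d t *F D t j) ≡ 0F
      zL*L+d*D≡0 j = trans (sym (cong₂ _+F_ (∑ᶠ-cong m (λ i → cong (zL i *F_) (A-↑ˡ i j))) (∑ᶠ-cong ℓ (λ t → cong (d t *F_) (A-↑ʳ t j)))))
                       (trans (sym (∑ᶠ-↑ m ℓ (λ i → z i *F A i j))) (zA≡0 j))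
      d·y≢0 : d · y ≢ 0F
      d·y≢0 d·y≡0 = z·rhs≢0 (trans (∑ᶠ-↑ m ℓ (λ i → z i *F rhs i))
        (trans (cong₂ _+F_ (trans (∑ᶠ-cong m (λ i → trans (cong (zL i *F_) (rhs-↑ˡ i)) (zeroʳ _))) (∑ᶠ-zero m))
                           (trans (∑ᶠ-cong ℓ (λ t → cong (d t *F_) (rhs-↑ʳ t))) d·y≡0))
        (+-identityˡ 0F)))
      induced : Induces 𝔽 L B (row d)
      induced x Lx≡0 _ = begin
        ∑ᶠ ℓ (λ t → d t *F x (lookup B t))                   ≡⟨ ∑ᶠ-cong ℓ (λ t → cong (d t *F_) (sym (∑ᶠ-δ k (lookup B t) x))) ⟩
        ∑ᶠ ℓ (λ t → d t *F ∑ᶠ k (λ j → D t j *F x j))         ≡⟨ ∑ᶠ-*-∑ᶠ ℓ k d D x ⟩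
        ∑ᶠ k (λ j → ∑ᶠ ℓ (λ t → d t *F D t j) *F x j)         ≡⟨ ∑ᶠ-cong k (λ j → cong (_*F x j) (+-inverseʳ-unique _ _ (zL*L+d*D≡0 j))) ⟩
        ∑ᶠ k (λ j → (-F ∑ᶠ m (λ i → zL i *F L i j)) *F x j)   ≡⟨ ∑ᶠ-cong k (λ j → sym (-‿distribˡ-* _ (x j))) ⟩
        ∑ᶠ k (λ j → -F (∑ᶠ m (λ i → zL i *F L i j) *F x j))   ≡⟨ ∑ᶠ-neg k _ ⟩
        -F ∑ᶠ k (λ j → ∑ᶠ m (λ i → zL i *F L i j) *F x j)     ≡⟨ cong -F_ (sym (∑ᶠ-*-∑ᶠ m k zL L x)) ⟩
        -F ∑ᶠ m (λ i → zL i *F ∑ᶠ k (λ j → L i j *F x j))     ≡⟨ cong -F_ (trans (∑ᶠ-cong m (λ i → trans (cong (zL i *F_) (Lx≡0 i)) (zeroʳ _)))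
                                                                                 (∑ᶠ-zero m)) ⟩
        -F 0F                                                ≡⟨ -0#≈0# ⟩
        0F                                                   ∎
        where open ≡-Reasoning

  extend-or-separate : ∀ {m k ℓ} (L : Sys 𝔽 m k) (B : Vec (Fin k) ℓ) (y : Fin ℓ → F 𝔽) →
    (∃ λ x → Kills 𝔽 L x × Extends B x y) ⊎ (∃ λ d → Induces 𝔽 L B (row d) × d · y ≢ 0F)
  extend-or-separate {m} {k} {ℓ} L B y =
    Sum.map (λ (x , sol) → x , extension x sol) (λ (z , obs) → z ∘ (m ↑ʳ_) , separation z obs) (fredholm (m ℕ.+ ℓ) k A rhs)
    where open Stacked L B y

  linIndep-∷ : ∀ {m′ ℓ} (M : Sys 𝔽 m′ ℓ) (d y : Fin ℓ → F 𝔽) →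
               LinIndep 𝔽 M → Kills 𝔽 M y → d · y ≢ 0F → LinIndep 𝔽 (d ∷ᶠ M)
  linIndep-∷ {m′} {ℓ} M d y indep My≡0 d·y≢0 c c[d∷M]≡0 = c≡0
    where
    R : Fin ℓ → F 𝔽
    R j = ∑ᶠ m′ (λ i → c (suc i) *F M i j)
    R·y≡0 : R · y ≡ 0F
    R·y≡0 = trans (sym (∑ᶠ-*-∑ᶠ m′ ℓ (c ∘ suc) M y))
                  (trans (∑ᶠ-cong m′ (λ i → trans (cong (c (suc i) *F_) (My≡0 i)) (zeroʳ _))) (∑ᶠ-zero m′))
    d·y*c₀≡0 : (d · y) *F c zero ≡ 0F
    d·y*c₀≡0 = begin
      (d · y) *F c zero                                         ≡⟨ *-comm _ _ ⟩
      c zero *F (d · y)                                         ≡⟨ sym (∑ᶠ-*ˡ ℓ (c zero) _) ⟩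
      ∑ᶠ ℓ (λ j → c zero *F (d j *F y j))                       ≡⟨ ∑ᶠ-cong ℓ (λ j → sym (*-assoc _ _ _)) ⟩
      ∑ᶠ ℓ (λ j → (c zero *F d j) *F y j)                       ≡⟨ sym (+-identityʳ _) ⟩
      ∑ᶠ ℓ (λ j → (c zero *F d j) *F y j) +F 0F                 ≡⟨ cong (∑ᶠ ℓ (λ j → (c zero *F d j) *F y j) +F_) (sym R·y≡0) ⟩
      ∑ᶠ ℓ (λ j → (c zero *F d j) *F y j) +F (R · y)            ≡⟨ sym (∑ᶠ-distrib-+ ℓ _ _) ⟩
      ∑ᶠ ℓ (λ j → ((c zero *F d j) *F y j) +F (R j *F y j))     ≡⟨ ∑ᶠ-cong ℓ (λ j → sym (distribʳ (y j) _ _)) ⟩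
      ∑ᶠ ℓ (λ j → ((c zero *F d j) +F R j) *F y j)              ≡⟨ ∑ᶠ-cong ℓ (λ j → trans (cong (_*F y j) (c[d∷M]≡0 j)) (zeroˡ _)) ⟩
      ∑ᶠ ℓ (λ j → 0F)                                           ≡⟨ ∑ᶠ-zero ℓ ⟩
      0F                                                        ∎
      where open ≡-Reasoning
    c₀≡0 : c zero ≡ 0F
    c₀≡0 = *-cancelˡ-nonZero _ _ d·y≢0 d·y*c₀≡0
    c≡0 : ∀ i → c i ≡ 0F
    c≡0 zero    = c₀≡0
    c≡0 (suc i) = indep (c ∘ suc) (λ j → trans (sym (+-identityˡ _))
                    (trans (cong (_+F R j) (sym (trans (cong (_*F d j) c₀≡0) (zeroˡ _)))) (c[d∷M]≡0 j))) i

  Entails : ∀ {m k m′ ℓ} → Sys 𝔽 m k → Vec (Fin k) ℓ → Sys 𝔽 m′ ℓ → Set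
  Entails {ℓ = ℓ} L B M = ∀ d y → Induces 𝔽 L B (row d) → Kills 𝔽 M y → d · y ≡ 0F

  entails-LB : ∀ {m k m′ ℓ} (L : Sys 𝔽 m k) (B : Vec (Fin k) ℓ) (M : Sys 𝔽 m′ ℓ) → IsLB 𝔽 L B M → Entails L B M
  entails-LB {m′ = m′} L B M (indep , induced , maximal) d y d-induced My≡0 =
    decidable-stable (d · y ≟ᶠ 0F) λ d·y≢0 →
      maximal (suc m′) (ℕ.n<1+n m′) (d ∷ᶠ M) (linIndep-∷ M d y indep My≡0 d·y≢0) (d∷M-induced)
    where
    d∷M-induced : Induces 𝔽 L B (d ∷ᶠ M)
    d∷M-induced x Lx≡0 zero    = d-induced x Lx≡0 zero
    d∷M-induced x Lx≡0 (suc i) = induced x Lx≡0 i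

  NoInducedEquation : ∀ {m k ℓ} → Sys 𝔽 m k → Vec (Fin k) ℓ → Set
  NoInducedEquation L B = ∀ d → Induces 𝔽 L B (row d) → ∀ t → d t ≡ 0F

  emptySys : ∀ ℓ → Sys 𝔽 0 ℓ
  emptySys ℓ ()

  entails-empty : ∀ {m k ℓ} (L : Sys 𝔽 m k) (B : Vec (Fin k) ℓ) → NoInducedEquation L B → Entails L B (emptySys ℓ)
  entails-empty {ℓ = ℓ} L B none d y d-induced _ =
    trans (∑ᶠ-cong ℓ (λ t → trans (cong (_*F y t) (none d d-induced t)) (zeroˡ _))) (∑ᶠ-zero ℓ)

  extend : ∀ {m k m′ ℓ} (L : Sys 𝔽 m k) (B : Vec (Fin k) ℓ) (M : Sys 𝔽 m′ ℓ) → Entails L B M →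
           ∀ y → Kills 𝔽 M y → ∃ λ x → Kills 𝔽 L x × Extends B x y
  extend L B M entails y My≡0 with extend-or-separate L B y
  ... | inj₁ extension            = extension
  ... | inj₂ (d , induced , d·y≢0) = ⊥-elim (d·y≢0 (entails d y induced My≡0))

module Solutions {q : ℕ} (𝔽 : FiniteField q) where
  open FiniteField 𝔽
  open FieldSums 𝔽

  Tuple : ℕ → ℕ → Set
  Tuple ℓ n = Fin ℓ → Pt 𝔽 n

  tuples : (ℓ n : ℕ) → List (Tuple ℓ n)
  tuples ℓ n = allFuns ℓ (allPts 𝔽 n)

  coordinate : ∀ {ℓ n} → Fin n → Tuple ℓ n → Fin ℓ → F 𝔽
  coordinate τ x j = x j τ

  _≈_ : ∀ {ℓ n} → Tuple ℓ n → Tuple ℓ n → Set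
  x ≈ y = ∀ j τ → x j τ ≡ y j τ

  _⊕_ : ∀ {ℓ n} → Tuple ℓ n → Tuple ℓ n → Tuple ℓ n
  (x ⊕ y) j τ = x j τ +F y j τ

  isSol-sound : ∀ {m′ ℓ n} (M : Sys 𝔽 m′ ℓ) (x : Tuple ℓ n) → isSol 𝔽 M x ≡ true → ∀ τ → Kills 𝔽 M (coordinate τ x)
  isSol-sound {m′} {ℓ} {n} M x sol τ i =
    ⌊⌋≡true⇒ (_ ≟ᶠ 0F) (allL-tabulate⁻ n id _ (allL-tabulate⁻ m′ id _ sol i) τ)

  isSol-complete : ∀ {m′ ℓ n} (M : Sys 𝔽 m′ ℓ) (x : Tuple ℓ n) → (∀ τ → Kills 𝔽 M (coordinate τ x)) → isSol 𝔽 M x ≡ true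
  isSol-complete {m′} {ℓ} {n} M x Mx≡0 =
    allL-tabulate⁺ m′ id _ (λ i → allL-tabulate⁺ n id _ (λ τ → ⌊⌋≡true⇐ (_ ≟ᶠ 0F) (Mx≡0 τ i)))

  isSol-cong : ∀ {m′ ℓ n} (M : Sys 𝔽 m′ ℓ) (x x′ : Tuple ℓ n) →
    (∀ i τ → ∑ᶠ ℓ (λ j → M i j *F x j τ) ≡ ∑ᶠ ℓ (λ j → M i j *F x′ j τ)) → isSol 𝔽 M x ≡ isSol 𝔽 M x′
  isSol-cong {m′} {ℓ} {n} M x x′ Mx≡Mx′ =
    allL-tabulate-cong m′ id _ _ (λ i → allL-tabulate-cong n id _ _ (λ τ → cong (λ v → ⌊ v ≟ᶠ 0F ⌋) (Mx≡Mx′ i τ)))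

  isSol-resp-≈ : ∀ {m′ ℓ n} (M : Sys 𝔽 m′ ℓ) {x x′ : Tuple ℓ n} → x ≈ x′ → isSol 𝔽 M x ≡ isSol 𝔽 M x′
  isSol-resp-≈ {ℓ = ℓ} M {x} {x′} x≈x′ = isSol-cong M x x′ (λ i τ → ∑ᶠ-cong ℓ (λ j → cong (M i j *F_) (x≈x′ j τ)))

  isSol-translate : ∀ {m′ ℓ n} (M : Sys 𝔽 m′ ℓ) (x z : Tuple ℓ n) → isSol 𝔽 M z ≡ true → isSol 𝔽 M (x ⊕ z) ≡ isSol 𝔽 M x
  isSol-translate {ℓ = ℓ} M x z z-sol = isSol-cong M (x ⊕ z) x (λ i τ →
    trans (∑ᶠ-cong ℓ (λ j → distribˡ (M i j) (x j τ) (z j τ)))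
    (trans (∑ᶠ-distrib-+ ℓ _ _) (trans (cong (_ +F_) (isSol-sound M z z-sol τ i)) (+-identityʳ _))))

  isSol-induced : ∀ {m k m′ ℓ n} (L : Sys 𝔽 m k) (B : Vec (Fin k) ℓ) (M : Sys 𝔽 m′ ℓ) → Induces 𝔽 L B M →
    ∀ (x : Tuple k n) → isSol 𝔽 L x ≡ true → isSol 𝔽 M (x ∘ lookup B) ≡ true
  isSol-induced L B M induced x x-sol = isSol-complete M _ (λ τ → induced (coordinate τ x) (isSol-sound L x x-sol τ))

  isSol-zero : ∀ {m′ ℓ} (M : Sys 𝔽 m′ ℓ) n → isSol 𝔽 {n = n} M (λ _ _ → 0F) ≡ true
  isSol-zero {ℓ = ℓ} M n = isSol-complete {n = n} M _ (λ τ i → trans (∑ᶠ-cong ℓ (λ j → zeroʳ (M i j))) (∑ᶠ-zero ℓ))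

  ∑-toList-tabulate : ∀ {N} (g : Fin N → F 𝔽) (G : F 𝔽 → ℚ) → ∑ (toList (Vec.tabulate g)) G ≡ ℚSum.sum (G ∘ g)
  ∑-toList-tabulate {zero}  g G = refl
  ∑-toList-tabulate {suc N} g G = cong (G (g zero) +_) (∑-toList-tabulate (g ∘ suc) G)

  fieldElements : List (F 𝔽)
  fieldElements = toList (Vec.tabulate id)

  fieldElements-translationInvariant : TranslationInvariant _≡_ _+F_ fieldElements
  fieldElements-translationInvariant c G _ = begin
    ∑ fieldElements (λ a → G (a +F c))    ≡⟨ ∑-toList-tabulate id (λ a → G (a +F c)) ⟩
    ℚSum.sum (λ a → G (a +F c))           ≡⟨ sym (ℚSum.sum-permute G +c) ⟩
    ℚSum.sum G                            ≡⟨ sym (∑-toList-tabulate id G) ⟩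
    ∑ fieldElements G                     ∎
    where
    open ≡-Reasoning
    +c : Permutation q q
    +c = permutation (_+F c) (_+F (-F c))
           (λ y → trans (+-assoc y _ c) (trans (cong (y +F_) (-‿inverseˡ c)) (+-identityʳ y)))
           (λ x → trans (+-assoc x c _) (trans (cong (x +F_) (-‿inverseʳ c)) (+-identityʳ x)))

  ∑-tuples-translate : ∀ ℓ n (z : Tuple ℓ n) (G : Tuple ℓ n → ℚ) → (∀ {x y} → x ≈ y → G x ≡ G y) →
                       ∑ (tuples ℓ n) (λ x → G (x ⊕ z)) ≡ ∑ (tuples ℓ n) G
  ∑-tuples-translate ℓ n =
    allFuns-translationInvariant (λ _ → refl) (allPts 𝔽 n)
      (allFuns-translationInvariant refl fieldElements fieldElements-translationInvariant n) ℓ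

  tuples-complete : ∀ ℓ n (x : Tuple ℓ n) → ∃ λ x′ → x′ ∈ tuples ℓ n × x′ ≈ x
  tuples-complete ℓ n x = allFuns-complete ℓ (allPts 𝔽 n) (Pointwise _≡_) x λ j →
    allFuns-complete n fieldElements _≡_ (x j) (λ τ → x j τ , ∈-toList⁺ (∈-tabulate⁺ id (x j τ)) , refl)

  -- Points are functions, so f : Pt 𝔽 n → ℚ need not respect pointwise equality;
  -- composing with canon makes it do so without changing f on allPts.
  canon : ∀ {n} → Pt 𝔽 n → Pt 𝔽 n
  canon {zero}  _ = λ ()
  canon {suc n} p = p zero ∷ᶠ canon (p ∘ suc)

  canon-cong : ∀ {n} {p p′ : Pt 𝔽 n} → (∀ τ → p τ ≡ p′ τ) → canon p ≡ canon p′
  canon-cong {zero}  p≗p′ = refl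
  canon-cong {suc n} p≗p′ = cong₂ _∷ᶠ_ (p≗p′ zero) (canon-cong (p≗p′ ∘ suc))

  canon-id : ∀ {n} {p : Pt 𝔽 n} → p ∈ allPts 𝔽 n → canon p ≡ p
  canon-id {zero}  (here refl) = refl
  canon-id {suc n} p∈ with ∈-allFuns-suc⁻ n fieldElements p∈
  ... | a , g , _ , g∈ , refl = cong (a ∷ᶠ_) (canon-id g∈)

  does-≟true : ∀ b → does (b ≟ᵇ true) ≡ b
  does-≟true true  = refl
  does-≟true false = refl

  ∑-sols : ∀ {m′ ℓ} (M : Sys 𝔽 m′ ℓ) n (g : Tuple ℓ n → ℚ) →
           ∑ (sols 𝔽 M n) g ≡ ∑ (tuples ℓ n) (λ x → 𝟙 (isSol 𝔽 M x) * g x)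
  ∑-sols {ℓ = ℓ} M n g = trans (∑-filter (λ x → isSol 𝔽 M x ≟ᵇ true) (tuples ℓ n) g)
                               (∑-cong (tuples ℓ n) (λ x → cong (λ b → 𝟙 b * g x) (does-≟true (isSol 𝔽 M x))))

  length-sols : ∀ {m′ ℓ} (M : Sys 𝔽 m′ ℓ) n → fromℕ (length (sols 𝔽 M n)) ≡ ∑ (tuples ℓ n) (𝟙 ∘ isSol 𝔽 M)
  length-sols {ℓ = ℓ} M n = trans (length-filter (λ x → isSol 𝔽 M x ≟ᵇ true) (tuples ℓ n))
                                  (∑-cong (tuples ℓ n) (λ x → cong 𝟙 (does-≟true (isSol 𝔽 M x))))

  sols-nonempty : ∀ {m′ ℓ} (M : Sys 𝔽 m′ ℓ) n → 1 ≤ length (sols 𝔽 M n)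
  sols-nonempty {ℓ = ℓ} M n with tuples-complete ℓ n (λ _ _ → 0F)
  ... | x , x∈ , x≈0 = nonempty (∈.∈-filter⁺ (λ x → isSol 𝔽 M x ≟ᵇ true) x∈ (trans (isSol-resp-≈ M x≈0) (isSol-zero M n)))
    where
    nonempty : ∀ {ys : List (Tuple ℓ n)} → x ∈ ys → 1 ≤ length ys
    nonempty {_ ∷ _} _ = s≤s z≤n

  Respects≈ : ∀ {ℓ n} → (Tuple ℓ n → ℚ) → Set
  Respects≈ h = ∀ {x y} → x ≈ y → h x ≡ h y

  module Projection {m k m′ ℓ} n (L : Sys 𝔽 m k) (B : Vec (Fin k) ℓ) (M : Sys 𝔽 m′ ℓ)
                    (induced : Induces 𝔽 L B M) (entails : InducedEquations.Entails 𝔽 L B M)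
                    (h : Tuple ℓ n → ℚ) (h-resp : Respects≈ h) where

    π : Tuple k n → Tuple ℓ n
    π x = x ∘ lookup B

    ι : ∀ {m″ ℓ′} → Sys 𝔽 m″ ℓ′ → Tuple ℓ′ n → ℚ
    ι N x = 𝟙 (isSol 𝔽 N x)

    lift-solution : ∀ y → isSol 𝔽 M y ≡ true → ∃ λ z → isSol 𝔽 L z ≡ true × π z ≈ y
    lift-solution y y-sol = z , isSol-complete L z (proj₁ ∘ proj₂ ∘ lifted) , λ t τ → proj₂ (proj₂ (lifted τ)) t
      where
      lifted : ∀ τ → ∃ λ x → Kills 𝔽 L x × InducedEquations.Extends 𝔽 B x (coordinate τ y)
      lifted τ = InducedEquations.extend 𝔽 L B M entails (coordinate τ y) (isSol-sound M y y-sol τ)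
      z : Tuple k n
      z j τ = proj₁ (lifted τ) j

    SL : ℚ
    SL = ∑ (tuples k n) (λ x → ι L x * h (π x))

    SM : ℚ
    SM = ∑ (tuples ℓ n) (λ y → ι M y * h y)

    ∑-L-shift : ∀ y → ι M y * SL ≡ ι M y * ∑ (tuples k n) (λ x → ι L x * h (π x ⊕ y))
    ∑-L-shift y with isSol 𝔽 M y in y-sol
    ... | false = trans (ℚ.*-zeroˡ SL) (sym (ℚ.*-zeroˡ (∑ (tuples k n) (λ x → ι L x * h (π x ⊕ y)))))
    ... | true with lift-solution y y-sol
    ...   | z , z-sol , πz≈y = cong (1ℚ *_) (begin
      SL                                              ≡⟨ sym (∑-tuples-translate k n z (λ x → ι L x * h (π x)) summand-resp) ⟩
      ∑ (tuples k n) (λ x → ι L (x ⊕ z) * h (π (x ⊕ z))) ≡⟨ ∑-cong (tuples k n) (λ x → cong₂ _*_ (cong 𝟙 (isSol-translate L x z z-sol))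
                                                                  (h-resp (λ t τ → cong (x (lookup B t) τ +F_) (πz≈y t τ)))) ⟩
      ∑ (tuples k n) (λ x → ι L x * h (π x ⊕ y))       ∎)
      where
      open ≡-Reasoning
      summand-resp : ∀ {x x′} → x ≈ x′ → ι L x * h (π x) ≡ ι L x′ * h (π x′)
      summand-resp x≈x′ = cong₂ _*_ (cong 𝟙 (isSol-resp-≈ L x≈x′)) (h-resp (x≈x′ ∘ lookup B))

    ∑-M-shift : ∀ x → ι L x * ∑ (tuples ℓ n) (λ y → ι M y * h (y ⊕ π x)) ≡ ι L x * SM
    ∑-M-shift x with isSol 𝔽 L x in x-sol
    ... | false = trans (ℚ.*-zeroˡ (∑ (tuples ℓ n) (λ y → ι M y * h (y ⊕ π x)))) (sym (ℚ.*-zeroˡ SM))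
    ... | true  = cong (1ℚ *_) (begin
      ∑ (tuples ℓ n) (λ y → ι M y * h (y ⊕ π x))           ≡⟨ ∑-cong (tuples ℓ n) (λ y → cong (_* h (y ⊕ π x))
                                                                (cong 𝟙 (sym (isSol-translate M y (π x) (isSol-induced L B M induced x x-sol))))) ⟩
      ∑ (tuples ℓ n) (λ y → ι M (y ⊕ π x) * h (y ⊕ π x))   ≡⟨ ∑-tuples-translate ℓ n (π x) (λ y → ι M y * h y)
                                                                (λ y≈y′ → cong₂ _*_ (cong 𝟙 (isSol-resp-≈ M y≈y′)) (h-resp y≈y′)) ⟩
      SM                                                  ∎)
      where open ≡-Reasoning

    double-count : ∑ (tuples ℓ n) (ι M) * SL ≡ ∑ (tuples k n) (ι L) * SM
    double-count = begin
      ∑ Y (ι M) * SL                                            ≡⟨ sym (∑-*ʳ Y SL (ι M)) ⟩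
      ∑ Y (λ y → ι M y * SL)                                    ≡⟨ ∑-cong Y ∑-L-shift ⟩
      ∑ Y (λ y → ι M y * ∑ X (λ x → ι L x * h (π x ⊕ y)))       ≡⟨ ∑-cong Y (λ y → sym (∑-*ˡ X (ι M y) _)) ⟩
      ∑ Y (λ y → ∑ X (λ x → ι M y * (ι L x * h (π x ⊕ y))))     ≡⟨ ∑-comm Y X _ ⟩
      ∑ X (λ x → ∑ Y (λ y → ι M y * (ι L x * h (π x ⊕ y))))     ≡⟨ ∑-cong X (λ x → ∑-cong Y (λ y → reorder x y)) ⟩
      ∑ X (λ x → ∑ Y (λ y → ι L x * (ι M y * h (y ⊕ π x))))     ≡⟨ ∑-cong X (λ x → ∑-*ˡ Y (ι L x) _) ⟩
      ∑ X (λ x → ι L x * ∑ Y (λ y → ι M y * h (y ⊕ π x)))       ≡⟨ ∑-cong X ∑-M-shift ⟩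
      ∑ X (λ x → ι L x * SM)                                    ≡⟨ ∑-*ʳ X SM (ι L) ⟩
      ∑ X (ι L) * SM                                            ∎
      where
      open ≡-Reasoning
      open +-*-Solver
      X : List (Tuple k n)
      X = tuples k n
      Y : List (Tuple ℓ n)
      Y = tuples ℓ n
      reorder : ∀ x y → ι M y * (ι L x * h (π x ⊕ y)) ≡ ι L x * (ι M y * h (y ⊕ π x))
      reorder x y = trans (solve 3 (λ a b c → a :* (b :* c) := b :* (a :* c)) refl (ι M y) (ι L x) (h (π x ⊕ y)))
                          (cong (λ v → ι L x * (ι M y * v)) (h-resp (λ t τ → +-comm _ _)))

    avg-project : avg (length (sols 𝔽 L n)) (∑ (sols 𝔽 L n) (h ∘ π)) ≡ avg (length (sols 𝔽 M n)) (∑ (sols 𝔽 M n) h)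
    avg-project = avg-cross _ _ _ _ (sols-nonempty L n) (sols-nonempty M n) (begin
      fromℕ (length (sols 𝔽 M n)) * ∑ (sols 𝔽 L n) (h ∘ π)   ≡⟨ cong₂ _*_ (length-sols M n) (∑-sols L n (h ∘ π)) ⟩
      ∑ (tuples ℓ n) (ι M) * SL                              ≡⟨ double-count ⟩
      ∑ (tuples k n) (ι L) * SM                              ≡⟨ sym (cong₂ _*_ (length-sols L n) (∑-sols M n h)) ⟩
      fromℕ (length (sols 𝔽 L n)) * ∑ (sols 𝔽 M n) h         ∎)
      where open ≡-Reasoning

module ShortEquations {q : ℕ} (𝔽 : FiniteField q) where
  open FiniteField 𝔽
  open FieldSums 𝔽
  open InducedEquations 𝔽 using (row; NoInducedEquation)

  liftEq : ∀ {k j} → Vec (Fin k) j → (Fin j → F 𝔽) → Fin k → F 𝔽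
  liftEq {j = j} B d i = ∑ᶠ j (λ t → d t *F δ (lookup B t) i)

  liftEq-lookup : ∀ {k j} (B : Vec (Fin k) j) → Increasing B → ∀ d t → liftEq B d (lookup B t) ≡ d t
  liftEq-lookup {j = j} B inc d t = trans (∑ᶠ-cong j (λ t′ → cong (d t′ *F_) (δ-lookup t′))) (∑ᶠ-δʳ j t d)
    where
    δ-lookup : ∀ t′ → δ (lookup B t′) (lookup B t) ≡ δ t′ t
    δ-lookup t′ with t′ ≟ᶠ t
    ... | yes refl = trans (δ-diag (lookup B t′)) (sym (δ-diag t))
    ... | no t′≢t  = trans (δ-offDiag _ _ (t′≢t ∘ increasing-injective B inc t′ t)) (sym (δ-offDiag t′ t t′≢t))

  liftEq-induced : ∀ {m k j} (L : Sys 𝔽 m k) (B : Vec (Fin k) j) d →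
                   Induces 𝔽 L B (row d) → Induces 𝔽 L (fullSet 𝔽 k) (row (liftEq B d))
  liftEq-induced {k = k} {j} L B d induced x Lx≡0 _ = begin
    ∑ᶠ k (λ i → liftEq B d i *F x (lookup (fullSet 𝔽 k) i))   ≡⟨ ∑ᶠ-cong k (λ i → cong (λ i′ → liftEq B d i *F x i′) (VecP.lookup∘tabulate id i)) ⟩
    ∑ᶠ k (λ i → liftEq B d i *F x i)                          ≡⟨ sym (∑ᶠ-*-∑ᶠ j k d (δ ∘ lookup B) x) ⟩
    ∑ᶠ j (λ t → d t *F ∑ᶠ k (λ i → δ (lookup B t) i *F x i))  ≡⟨ ∑ᶠ-cong j (λ t → cong (d t *F_) (∑ᶠ-δ k (lookup B t) x)) ⟩
    ∑ᶠ j (λ t → d t *F x (lookup B t))                        ≡⟨ induced x Lx≡0 zero ⟩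
    0F                                                        ∎
    where open ≡-Reasoning

  eqLength-liftEq : ∀ {k j} (B : Vec (Fin k) j) d → eqLength 𝔽 (liftEq B d) ≤ j
  eqLength-liftEq {k} {j} B d = begin
    eqLength 𝔽 (liftEq B d)                                ≡⟨ length-filter-tabulate k id (λ i → ¬? (liftEq B d i ≟ᶠ 0F)) ⟩
    ∑ℕ k (λ i → bit (does (¬? (liftEq B d i ≟ᶠ 0F))))      ≤⟨ ∑ℕ-mono-≤ k hit≤count ⟩
    ∑ℕ k (λ i → ∑ℕ j (λ t → bit (does (lookup B t ≟ᶠ i)))) ≡⟨ ℕSum.∑-comm (λ i t → bit (does (lookup B t ≟ᶠ i))) ⟩
    ∑ℕ j (λ t → ∑ℕ k (λ i → bit (does (lookup B t ≟ᶠ i)))) ≡⟨ ℕSum.sum-cong-≗ (λ t → ∑ℕ-δ k (lookup B t)) ⟩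
    ∑ℕ j (λ _ → 1)                                         ≡⟨ ∑ℕ-ones j ⟩
    j                                                      ∎
    where
    open ℕ.≤-Reasoning
    hit≤count : ∀ i → bit (does (¬? (liftEq B d i ≟ᶠ 0F))) ≤ ∑ℕ j (λ t → bit (does (lookup B t ≟ᶠ i)))
    hit≤count i with FinP.any? (λ t → lookup B t ≟ᶠ i)
    ... | yes (t , B[t]≡i) = ℕ.≤-trans (bit≤1 _) (ℕ.≤-trans (ℕ.≤-reflexive (sym (cong bit (dec-true (lookup B t ≟ᶠ i) B[t]≡i))))
                                                             (∑ℕ-term j (λ t′ → bit (does (lookup B t′ ≟ᶠ i))) t))
      where
      bit≤1 : ∀ b → bit b ≤ 1
      bit≤1 true  = s≤s z≤n
      bit≤1 false = z≤n
    ... | no  i∉B = subst (_≤ ∑ℕ j (λ t → bit (does (lookup B t ≟ᶠ i))))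
                          (sym (cong bit (dec-false (¬? (liftEq B d i ≟ᶠ 0F)) (λ lift≢0 → lift≢0 lift≡0)))) z≤n
      where
      lift≡0 : liftEq B d i ≡ 0F
      lift≡0 = trans (∑ᶠ-cong j (λ t → trans (cong (d t *F_) (δ-offDiag (lookup B t) i (λ B[t]≡i → i∉B (t , B[t]≡i)))) (zeroʳ _)))
                     (∑ᶠ-zero j)

  eqLength-nontrivial : ∀ {k} (e : Fin k → F 𝔽) → Nontrivial 𝔽 e → 1 ≤ eqLength 𝔽 e
  eqLength-nontrivial {k} e (i , eᵢ≢0) = nonempty (∈.∈-filter⁺ (λ j → ¬? (e j ≟ᶠ 0F)) (∈-toList⁺ (∈-tabulate⁺ id i)) eᵢ≢0)
    where
    nonempty : ∀ {ys : List (Fin k)} → i ∈ ys → 1 ≤ length ys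
    nonempty {_ ∷ _} _ = s≤s z≤n

  noInducedEquation-short : ∀ {m k j} (L : Sys 𝔽 m k) s → IsMinLength 𝔽 L s →
    (B : Vec (Fin k) j) → Increasing B → j < s → NoInducedEquation L B
  noInducedEquation-short L s (_ , s-minimal) B inc j<s d induced t = decidable-stable (d t ≟ᶠ 0F) λ dₜ≢0 →
    ℕ.<-irrefl refl (ℕ.≤-<-trans (ℕ.≤-trans (s-minimal (liftEq B d) (nontrivial dₜ≢0 , liftEq-induced L B d induced))
                                            (eqLength-liftEq B d)) j<s)
    where
    nontrivial : d t ≢ 0F → Nontrivial 𝔽 (liftEq B d)
    nontrivial dₜ≢0 = lookup B t , dₜ≢0 ∘ trans (sym (liftEq-lookup B inc d t))

  noInducedEquation-nonCritical : ∀ {m k c} (L : Sys 𝔽 m k) (B : Vec (Fin k) c) → Increasing B →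
    ¬ Critical 𝔽 L c B → NoInducedEquation L B
  noInducedEquation-nonCritical L B inc nonCritical d induced t = decidable-stable (d t ≟ᶠ 0F) λ dₜ≢0 →
    nonCritical (inc , 1 , s≤s z≤n , row d , independent dₜ≢0 , induced)
    where
    independent : d t ≢ 0F → LinIndep 𝔽 (row d)
    independent dₜ≢0 c cd≡0 zero =
      *-cancelˡ-nonZero (d t) (c zero) dₜ≢0 (trans (*-comm (d t) (c zero)) (trans (sym (+-identityʳ _)) (cd≡0 t)))

module Correlations {q : ℕ} (𝔽 : FiniteField q) {m k : ℕ} (L : Sys 𝔽 m k) (n : ℕ) (f : Pt 𝔽 n → ℚ) where
  open FiniteField 𝔽
  open Solutions 𝔽
  open InducedEquations 𝔽 using (Entails; NoInducedEquation; emptySys; entails-empty)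

  f̂ : Pt 𝔽 n → ℚ
  f̂ = f ∘ canon

  Λ-f̂ : ∀ {m′ ℓ} (M : Sys 𝔽 m′ ℓ) → Λ 𝔽 M f̂ ≡ Λ 𝔽 M f
  Λ-f̂ {ℓ = ℓ} M = cong (avg (length (sols 𝔽 M n))) (∑-cong-∈ (sols 𝔽 M n) λ y y∈ →
    prodℚ-cong ℓ (λ i → cong f (canon-id (allFuns-∈ ℓ (allPts 𝔽 n) (tuple∈ y∈) i))))
    where
    tuple∈ : ∀ {y} → y ∈ sols 𝔽 M n → y ∈ tuples ℓ n
    tuple∈ y∈ = proj₁ (∈.∈-filter⁻ (λ x → isSol 𝔽 M x ≟ᵇ true) {xs = tuples ℓ n} y∈)

  ∏f̂ : ∀ j → Tuple j n → ℚ
  ∏f̂ j y = prodℚ j (f̂ ∘ y)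

  ∏f̂-resp : ∀ j → Respects≈ (∏f̂ j)
  ∏f̂-resp j y≈y′ = prodℚ-cong j (λ t → cong f (canon-cong (y≈y′ t)))

  corr : Sub k → ℚ
  corr (j , B) = avg (length (sols 𝔽 L n)) (∑ (sols 𝔽 L n) (∏f̂ j ∘ (_∘ lookup B)))

  corr-empty : corr (0 , []) ≡ 1ℚ
  corr-empty = avg-∑-const (sols 𝔽 L n) 1ℚ (sols-nonempty L n)

  corr-project : ∀ {j m′} (B : Vec (Fin k) j) (M : Sys 𝔽 m′ j) → Induces 𝔽 L B M → Entails L B M →
                 corr (j , B) ≡ Λ 𝔽 M f̂
  corr-project {j} B M induced entails = Projection.avg-project n L B M induced entails (∏f̂ j) (∏f̂-resp j)

  corr-≤ : Bounded 𝔽 f → ∀ p → corr p ≤ℚ halfPow (proj₁ p)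
  corr-≤ bounded (j , B) = avg-≤ (sols 𝔽 L n) _ (halfPow j) (sols-nonempty L n) λ x _ →
    ℚ.≤-trans (p≤∣p∣ _) (∣prodℚ∣≤halfPow j (f̂ ∘ x ∘ lookup B) (λ t → f̂-abs (x (lookup B t))))
    where
    f̂-abs : ∀ p → ∣ f̂ p ∣ ≤ℚ ½
    f̂-abs p = -q≤p≤q⇒∣p∣≤q (f̂ p) ½ (proj₁ (bounded (canon p))) (proj₂ (bounded (canon p)))

  Λ-empty : Balanced 𝔽 f → ∀ j → Λ 𝔽 (emptySys (suc j)) f̂ ≡ 0ℚ
  Λ-empty balanced j = trans (cong (avg (length (sols 𝔽 (emptySys (suc j)) n))) ∑≡0) (avg-zero (length (sols 𝔽 (emptySys (suc j)) n)))
    where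
    open ≡-Reasoning
    ∑f̂≡0 : ∑ (allPts 𝔽 n) f̂ ≡ 0ℚ
    ∑f̂≡0 = trans (∑-cong-∈ (allPts 𝔽 n) (λ p p∈ → cong f (canon-id p∈))) balanced
    ∑≡0 : ∑ (sols 𝔽 (emptySys (suc j)) n) (∏f̂ (suc j)) ≡ 0ℚ
    ∑≡0 = begin
      ∑ (sols 𝔽 (emptySys (suc j)) n) (∏f̂ (suc j))                        ≡⟨ ∑-sols (emptySys (suc j)) n (∏f̂ (suc j)) ⟩
      ∑ (tuples (suc j) n) (λ y → 1ℚ * ∏f̂ (suc j) y)                      ≡⟨ ∑-cong (tuples (suc j) n) (λ y → ℚ.*-identityˡ _) ⟩
      ∑ (tuples (suc j) n) (∏f̂ (suc j))                                   ≡⟨ ∑-allFuns-suc j (allPts 𝔽 n) (∏f̂ (suc j)) ⟩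
      ∑ (allPts 𝔽 n) (λ a → ∑ (tuples j n) (λ y → f̂ a * ∏f̂ j y))          ≡⟨ ∑-cong (allPts 𝔽 n) (λ a → ∑-*ˡ (tuples j n) (f̂ a) (∏f̂ j)) ⟩
      ∑ (allPts 𝔽 n) (λ a → f̂ a * ∑ (tuples j n) (∏f̂ j))                  ≡⟨ ∑-*ʳ (allPts 𝔽 n) _ f̂ ⟩
      ∑ (allPts 𝔽 n) f̂ * ∑ (tuples j n) (∏f̂ j)                           ≡⟨ cong (_* ∑ (tuples j n) (∏f̂ j)) ∑f̂≡0 ⟩
      0ℚ * ∑ (tuples j n) (∏f̂ j)                                          ≡⟨ ℚ.*-zeroˡ (∑ (tuples j n) (∏f̂ j)) ⟩
      0ℚ                                                                  ∎

  -- Without an induced equation the projection of sol(L) to B is onto, and f̂ averages to 0.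
  corr-free : Balanced 𝔽 f → ∀ {j} (B : Vec (Fin k) (suc j)) → NoInducedEquation L B → corr (suc j , B) ≡ 0ℚ
  corr-free balanced {j} B none =
    trans (corr-project B (emptySys (suc j)) (λ _ _ ()) (entails-empty L B none)) (Λ-empty balanced j)

  Λ-expansion : ∀ β (g : Pt 𝔽 n → ℚ) → (∀ p → g p ≡ ½ * (1ℚ + β * f̂ p)) →
                Λ 𝔽 L g ≡ halfPow k * ∑ (subsets k) (λ p → β ^ proj₁ p * corr p)
  Λ-expansion β g g≡ = begin
    avg N (∑ X (λ x → prodℚ k (g ∘ x)))                              ≡⟨ cong (avg N) (∑-cong X expand) ⟩
    avg N (∑ X (λ x → halfPow k * ∑ (subsets k) (λ p → w p * Π x p))) ≡⟨ cong (avg N) (trans (∑-*ˡ X (halfPow k) _) (cong (halfPow k *_) swap)) ⟩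
    avg N (halfPow k * ∑ (subsets k) (λ p → w p * S p))              ≡⟨ avg-* N _ ⟩
    (halfPow k * ∑ (subsets k) (λ p → w p * S p)) * r                ≡⟨ ℚ.*-assoc (halfPow k) _ r ⟩
    halfPow k * (∑ (subsets k) (λ p → w p * S p) * r)                ≡⟨ cong (halfPow k *_) (trans (sym (∑-*ʳ (subsets k) r (λ p → w p * S p)))
                                                                          (∑-cong (subsets k) average)) ⟩
    halfPow k * ∑ (subsets k) (λ p → w p * corr p)                   ∎
    where
    open ≡-Reasoning
    N : ℕ
    N = length (sols 𝔽 L n)
    X : List (Tuple k n)
    X = sols 𝔽 L n
    r : ℚ
    r = avg N 1ℚ
    w : Sub k → ℚ
    w p = β ^ proj₁ p
    Π : Tuple k n → Sub k → ℚ
    Π x (j , B) = ∏f̂ j (x ∘ lookup B)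
    S : Sub k → ℚ
    S p = ∑ X (λ x → Π x p)
    expand : ∀ x → prodℚ k (g ∘ x) ≡ halfPow k * ∑ (subsets k) (λ p → w p * Π x p)
    expand x = trans (prodℚ-cong k (g≡ ∘ x))
                 (trans (prodℚ-½* k (λ i → 1ℚ + β * f̂ (x i))) (cong (halfPow k *_) (prodℚ-binomial k β (f̂ ∘ x))))
    swap : ∑ X (λ x → ∑ (subsets k) (λ p → w p * Π x p)) ≡ ∑ (subsets k) (λ p → w p * S p)
    swap = trans (∑-comm X (subsets k) (λ x p → w p * Π x p)) (∑-cong (subsets k) (λ p → ∑-*ˡ X (w p) (λ x → Π x p)))
    average : ∀ p → (w p * S p) * r ≡ w p * corr p
    average p@(j , B) = trans (ℚ.*-assoc (w p) (S p) r) (cong (w p *_) (sym (avg-* N (S p))))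

  Δ-expansion : ∀ ε → Δ 𝔽 L (λ x → ε * f̂ x) ≡
                halfPow k * ∑ (subsets k) (λ p → ((ε + ε) ^ proj₁ p + (- (ε + ε)) ^ proj₁ p) * corr p)
  Δ-expansion ε = begin
    Λ 𝔽 L (λ x → ½ + ε * f̂ x) + Λ 𝔽 L (λ x → ½ - ε * f̂ x)
      ≡⟨ cong₂ _+_ (Λ-expansion β _ (λ p → plus (f̂ p))) (Λ-expansion (- β) _ (λ p → minus (f̂ p))) ⟩
    halfPow k * ∑ (subsets k) (λ p → β ^ proj₁ p * corr p) + halfPow k * ∑ (subsets k) (λ p → (- β) ^ proj₁ p * corr p)
      ≡⟨ sym (ℚ.*-distribˡ-+ (halfPow k) _ _) ⟩
    halfPow k * (∑ (subsets k) (λ p → β ^ proj₁ p * corr p) + ∑ (subsets k) (λ p → (- β) ^ proj₁ p * corr p))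
      ≡⟨ cong (halfPow k *_) (trans (sym (∑-distrib-+ (subsets k) _ _))
                                    (∑-cong (subsets k) (λ p → sym (ℚ.*-distribʳ-+ (corr p) (β ^ proj₁ p) _)))) ⟩
    halfPow k * ∑ (subsets k) (λ p → (β ^ proj₁ p + (- β) ^ proj₁ p) * corr p) ∎
    where
    open ≡-Reasoning
    open +-*-Solver
    β : ℚ
    β = ε + ε
    plus : ∀ y → ½ + ε * y ≡ ½ * (1ℚ + β * y)
    plus = solve 2 (λ e y → con ½ :+ e :* y := con ½ :* (con 1ℚ :+ (e :+ e) :* y)) refl ε
    minus : ∀ y → ½ - ε * y ≡ ½ * (1ℚ + (- β) * y)
    minus = solve 2 (λ e y → con ½ :- e :* y := con ½ :* (con 1ℚ :+ (:- (e :+ e)) :* y)) refl ε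

  module CriticalTerms (balanced : Balanced 𝔽 f) {c} (es : List (CritEntry 𝔽 k c)) (enum : EnumeratesCrit 𝔽 L c es) where
    open InducedEquations 𝔽 using (entails-LB)
    open ShortEquations 𝔽 using (noInducedEquation-nonCritical)

    _≟ᵥ_ : DecidableEquality (Vec (Fin k) c)
    _≟ᵥ_ = VecP.≡-dec Fin._≟_

    open import Data.List.Membership.DecPropositional _≟ᵥ_ using () renaming (_∈?_ to _∈ᵥ?_)

    unique : Unique (map set es)
    unique = proj₁ enum

    critical⇔∈ : ∀ B → Critical 𝔽 L c B ⇔ B ∈ map set es
    critical⇔∈ = proj₁ (proj₂ enum)

    isLB : All (λ e → IsLB 𝔽 L (set e) (sys e)) es
    isLB = proj₂ (proj₂ enum)

    V : CritEntry 𝔽 k c → ℚ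
    V e = Λ 𝔽 (sys e) f̂

    critical : Sub k → ℚ
    critical p = ∑ es (λ e → 𝟙 (does (key p ≟ₗ toList (set e))) * V e)

    critical-offSize : ∀ p → proj₁ p ≢ c → critical p ≡ 0ℚ
    critical-offSize (j , B) j≢c = ∑-select-∉ _≟ₗ_ (toList ∘ set) V es (toList B) λ B∈ →
      let e , _ , toList[e]≡B = ∈.∈-map⁻ (toList ∘ set) B∈ in
      j≢c (trans (sym (VecP.length-toList B)) (trans (cong length toList[e]≡B) (VecP.length-toList (set e))))

    critical-size : ∀ (B : Vec (Fin k) c) → critical (c , B) ≡ ∑ es (λ e → 𝟙 (does (B ≟ᵥ set e)) * V e)
    critical-size B = ∑-cong es λ e → cong (_* V e)
      (𝟙-does-⇔ (toList B ≟ₗ toList (set e)) (B ≟ᵥ set e) (toList-injective B (set e)) (cong toList))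

    corr-critical : 1 ≤ c → ∀ (B : Vec (Fin k) c) → Increasing B → corr (c , B) ≡ critical (c , B)
    corr-critical 1≤c B inc with B ∈ᵥ? map set es
    ... | yes B∈ with ∑-select _≟ᵥ_ set V es B unique B∈
    ...   | e , e∈ , refl , ∑≡V =
      trans (corr-project B (sys e) (proj₁ (proj₂ (All.lookup isLB e∈))) (entails-LB L B (sys e) (All.lookup isLB e∈)))
            (sym (trans (critical-size B) ∑≡V))
    corr-critical (s≤s z≤n) B inc | no B∉ =
      trans (corr-free balanced B (noInducedEquation-nonCritical L B inc (B∉ ∘ Equivalence.to (critical⇔∈ B))))
            (sym (trans (critical-size B) (∑-select-∉ _≟ᵥ_ set V es B B∉)))

    ∑-critical : ∑ (subsets k) critical ≡ ∑ es V
    ∑-critical = trans (∑-comm (subsets k) es (λ p e → 𝟙 (does (key p ≟ₗ toList (set e))) * V e))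
      (∑-cong-∈ es λ e e∈ → begin
        ∑ (subsets k) (λ p → 𝟙 (does (key p ≟ₗ toList (set e))) * V e) ≡⟨ ∑-*ʳ (subsets k) (V e) _ ⟩
        ∑ (subsets k) (λ p → 𝟙 (does (key p ≟ₗ toList (set e)))) * V e ≡⟨ cong (_* V e)
                                                                             (∑-subsets-key k (increasing⇒increasingₗ (set e) (increasing e∈))) ⟩
        1ℚ * V e                                                       ≡⟨ ℚ.*-identityˡ (V e) ⟩
        V e                                                            ∎)
      where
      open ≡-Reasoning
      increasing : ∀ {e} → e ∈ es → Increasing (set e)
      increasing {e} e∈ = proj₁ (Equivalence.from (critical⇔∈ (set e)) (∈.∈-map⁺ set e∈))

  module Estimate (bounded : Bounded 𝔽 f) (balanced : Balanced 𝔽 f) (s : ℕ) (s-min : IsMinLength 𝔽 L s)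
                  (es : List (CritEntry 𝔽 k (cOf s))) (enum : EnumeratesCrit 𝔽 L (cOf s) es)
                  (ε : ℚ) (0<ε : 0ℚ <ℚ ε) (ε≤1 : ε ≤ℚ 1ℚ) where
    open CriticalTerms balanced es enum
    open ShortEquations 𝔽 using (eqLength-nontrivial; noInducedEquation-short)

    c : ℕ
    c = cOf s

    1≤c : 1 ≤ c
    1≤c with proj₁ s-min
    ... | e , (nontrivial , _) , refl = ℕ.≤-trans (eqLength-nontrivial e nontrivial) (s≤cOf s)

    0≤ε : 0ℚ ≤ℚ ε
    0≤ε = ℚ.<⇒≤ 0<ε

    β : ℚ
    β = ε + ε

    A : ℚ
    A = ∑ es V

    E : ℚ
    E = two * ε ^ suc c

    0≤E : 0ℚ ≤ℚ E
    0≤E = *-nonNeg (ℚ.<⇒≤ 0<two) (^-nonNeg (suc c) 0≤ε)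

    term : Sub k → ℚ
    term p = (β ^ proj₁ p + (- β) ^ proj₁ p) * corr p

    -- Its three summands account for B = ∅, for the critical sets and for the sets larger than c(L).
    bound : Sub k → ℚ
    bound p = (two * 𝟙 (does (proj₁ p ℕ.≟ 0)) + two * (β ^ c * critical p)) + E

    bound-generic : ∀ p → proj₁ p ≢ 0 → proj₁ p ≢ c → bound p ≡ E
    bound-generic p j≢0 j≢c = begin
      (two * 𝟙 (does (proj₁ p ℕ.≟ 0)) + two * (β ^ c * critical p)) + E
        ≡⟨ cong₂ (λ a b → (two * 𝟙 a + two * (β ^ c * b)) + E) (dec-false (proj₁ p ℕ.≟ 0) j≢0) (critical-offSize p j≢c) ⟩
      (two * 0ℚ + two * (β ^ c * 0ℚ)) + E
        ≡⟨ solve 2 (λ b e → (con two :* con 0ℚ :+ con two :* (b :* con 0ℚ)) :+ e := e) refl (β ^ c) E ⟩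
      E ∎
      where
      open ≡-Reasoning
      open +-*-Solver

    ≤+E : ∀ a → a ≤ℚ a + E
    ≤+E a = subst (_≤ℚ a + E) (ℚ.+-identityʳ a) (ℚ.+-monoʳ-≤ a 0≤E)

    term-odd : ∀ p → isEven (proj₁ p) ≡ false → term p ≡ 0ℚ
    term-odd p odd = trans (cong (_* corr p) (^+[-x]^-odd β (proj₁ p) odd)) (ℚ.*-zeroˡ (corr p))

    term-even : ∀ p → isEven (proj₁ p) ≡ true → term p ≡ two * (β ^ proj₁ p * corr p)
    term-even p even = trans (cong (_* corr p) (^+[-x]^-even β (proj₁ p) even)) (ℚ.*-assoc two (β ^ proj₁ p) (corr p))

    even-bound : ∀ j (B : Vec (Fin k) j) → isEven j ≡ true → Increasing B → two * (β ^ j * corr (j , B)) ≤ℚ bound (j , B)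
    even-bound j B even inc with ℕ.<-cmp j c
    ... | tri≈ _ refl _ = begin
      two * (β ^ c * corr (c , B))                                        ≡⟨ cong (λ x → two * (β ^ c * x)) (corr-critical 1≤c B inc) ⟩
      two * (β ^ c * critical (c , B))                                    ≡⟨ sym (ℚ.+-identityˡ (two * (β ^ c * critical (c , B)))) ⟩
      0ℚ + two * (β ^ c * critical (c , B))                               ≤⟨ ℚ.+-monoˡ-≤ (two * (β ^ c * critical (c , B)))
                                                                                (*-nonNeg (ℚ.<⇒≤ 0<two) (0≤𝟙 (does (c ℕ.≟ 0)))) ⟩
      two * 𝟙 (does (c ℕ.≟ 0)) + two * (β ^ c * critical (c , B))         ≤⟨ ≤+E _ ⟩
      bound (c , B)                                                       ∎
      where open ℚ.≤-Reasoning
    ... | tri> _ _ c<j = begin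
      two * (β ^ j * corr (j , B))        ≤⟨ ℚ.*-monoˡ-≤-nonNeg two {{ℚ.nonNegative (ℚ.<⇒≤ 0<two)}}
                                               (ℚ.*-monoˡ-≤-nonNeg (β ^ j) {{ℚ.nonNegative (^-nonNeg j (ℚ.+-mono-≤ 0≤ε 0≤ε))}} (corr-≤ bounded (j , B))) ⟩
      two * (β ^ j * halfPow j)           ≡⟨ cong (two *_) ([x+x]^*halfPow ε j) ⟩
      two * ε ^ j                         ≤⟨ ℚ.*-monoˡ-≤-nonNeg two {{ℚ.nonNegative (ℚ.<⇒≤ 0<two)}} (^-antitone (suc c) j 0≤ε ε≤1 c<j) ⟩
      E                                   ≡⟨ sym (bound-generic (j , B) (λ j≡0 → ℕ.n≮0 (subst (c <_) j≡0 c<j)) (λ j≡c → ℕ.<-irrefl (sym j≡c) c<j)) ⟩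
      bound (j , B)                       ∎
      where open ℚ.≤-Reasoning
    even-bound zero [] even inc | tri< _ _ _ = begin
      two * (1ℚ * corr (0 , []))                          ≡⟨ cong (λ x → two * (1ℚ * x)) corr-empty ⟩
      two * (1ℚ * 1ℚ)                                     ≡⟨ solve 1 (λ b → con two :* (con 1ℚ :* con 1ℚ) := con two :* con 1ℚ :+ con two :* (b :* con 0ℚ)) refl (β ^ c) ⟩
      two * 1ℚ + two * (β ^ c * 0ℚ)                       ≡⟨ cong (λ x → two * 1ℚ + two * (β ^ c * x)) (sym (critical-offSize (0 , []) (λ 0≡c → ℕ.<-irrefl 0≡c 1≤c))) ⟩
      two * 1ℚ + two * (β ^ c * critical (0 , []))        ≤⟨ ≤+E _ ⟩
      bound (0 , [])                                      ∎
      where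
      open ℚ.≤-Reasoning
      open +-*-Solver
    even-bound (suc j) B even inc | tri< j<c _ _ = begin
      two * (β ^ suc j * corr (suc j , B))   ≡⟨ cong (λ x → two * (β ^ suc j * x)) (corr-free balanced B
                                                   (noInducedEquation-short L s s-min B inc (even<cOf⇒<s s (suc j) even j<c))) ⟩
      two * (β ^ suc j * 0ℚ)                 ≡⟨ solve 1 (λ b → con two :* (b :* con 0ℚ) := con 0ℚ) refl (β ^ suc j) ⟩
      0ℚ                                     ≤⟨ 0≤E ⟩
      E                                      ≡⟨ sym (bound-generic (suc j , B) (λ ()) (λ j≡c → ℕ.<-irrefl j≡c j<c)) ⟩
      bound (suc j , B)                      ∎
      where
      open ℚ.≤-Reasoning
      open +-*-Solver

    term-≤-bound : ∀ p → p ∈ subsets k → term p ≤ℚ bound p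
    term-≤-bound p@(j , B) p∈ with isEven j in parity
    ... | true  = subst (_≤ℚ bound p) (sym (term-even p parity)) (even-bound j B parity (subsets-increasing k p∈))
    ... | false = subst₂ _≤ℚ_ (sym (term-odd p parity)) (sym (bound-generic p j≢0 j≢c)) 0≤E
      where
      true≢false : true ≢ false
      true≢false ()
      j≢0 : j ≢ 0
      j≢0 j≡0 = true≢false (trans (sym (cong isEven j≡0)) parity)
      j≢c : j ≢ c
      j≢c j≡c = true≢false (trans (sym (trans (cong isEven j≡c) (cOf-even s))) parity)

    ∑-bound : ∑ (subsets k) bound ≡ (two * 1ℚ + two * (β ^ c * A)) + two ^ k * E
    ∑-bound = begin
      ∑ (subsets k) bound
        ≡⟨ ∑-distrib-+ (subsets k) (λ p → two * 𝟙 (does (proj₁ p ℕ.≟ 0)) + two * (β ^ c * critical p)) (λ _ → E) ⟩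
      ∑ (subsets k) (λ p → two * 𝟙 (does (proj₁ p ℕ.≟ 0)) + two * (β ^ c * critical p)) + ∑ (subsets k) (λ _ → E)
        ≡⟨ cong₂ _+_ (∑-distrib-+ (subsets k) _ _) (∑-subsets-const k E) ⟩
      (∑ (subsets k) (λ p → two * 𝟙 (does (proj₁ p ℕ.≟ 0))) + ∑ (subsets k) (λ p → two * (β ^ c * critical p))) + two ^ k * E
        ≡⟨ cong (λ x → x + two ^ k * E) (cong₂ _+_
             (trans (∑-*ˡ (subsets k) two _) (cong (two *_) (∑-subsets-empty k)))
             (trans (∑-*ˡ (subsets k) two _) (cong (two *_) (trans (∑-*ˡ (subsets k) (β ^ c) critical) (cong (β ^ c *_) ∑-critical))))) ⟩
      (two * 1ℚ + two * (β ^ c * A)) + two ^ k * E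
        ∎
      where open ≡-Reasoning

    Δ-≤ : Δ 𝔽 L (λ x → ε * f̂ x) ≤ℚ halfPow k * ((two * 1ℚ + two * (β ^ c * A)) + two ^ k * E)
    Δ-≤ = begin
      Δ 𝔽 L (λ x → ε * f̂ x)                   ≡⟨ Δ-expansion ε ⟩
      halfPow k * ∑ (subsets k) term          ≤⟨ ℚ.*-monoˡ-≤-nonNeg (halfPow k) {{ℚ.nonNegative (ℚ.<⇒≤ (halfPow-pos k))}}
                                                    (∑-mono-≤ (subsets k) term-≤-bound) ⟩
      halfPow k * ∑ (subsets k) bound         ≡⟨ cong (halfPow k *_) ∑-bound ⟩
      halfPow k * ((two * 1ℚ + two * (β ^ c * A)) + two ^ k * E) ∎
      where open ℚ.≤-Reasoning

    Δ-< : 1 ≤ k → β ^ c * A + two ^ k * ε ^ suc c <ℚ 0ℚ → Δ 𝔽 L (λ x → ε * f̂ x) <ℚ halfPow (k ∸ 1)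
    Δ-< 1≤k X<0 = begin-strict
      Δ 𝔽 L (λ x → ε * f̂ x)                                         ≤⟨ Δ-≤ ⟩
      halfPow k * ((two * 1ℚ + two * (β ^ c * A)) + two ^ k * E)   ≡⟨ factor k 1≤k ⟩
      halfPow (k ∸ 1) * (1ℚ + X)                                    <⟨ ℚ.*-monoʳ-<-pos (halfPow (k ∸ 1)) {{ℚ.positive (halfPow-pos (k ∸ 1))}}
                                                                         (subst (1ℚ + X <ℚ_) (ℚ.+-identityʳ 1ℚ) (ℚ.+-monoʳ-< 1ℚ X<0)) ⟩
      halfPow (k ∸ 1) * 1ℚ                                          ≡⟨ ℚ.*-identityʳ _ ⟩
      halfPow (k ∸ 1)                                               ∎
      where
      open ℚ.≤-Reasoning
      open +-*-Solver
      X : ℚ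
      X = β ^ c * A + two ^ k * ε ^ suc c
      factor : ∀ k′ → 1 ≤ k′ → halfPow k′ * ((two * 1ℚ + two * (β ^ c * A)) + two ^ k′ * E)
                                  ≡ halfPow (k′ ∸ 1) * (1ℚ + (β ^ c * A + two ^ k′ * ε ^ suc c))
      factor (suc k′) _ =
        solve 5 (λ h b a t e → (con ½ :* h) :* ((con two :* con 1ℚ :+ con two :* (b :* a)) :+ (con two :* t) :* (con two :* e))
                               := h :* (con 1ℚ :+ (b :* a :+ (con two :* t) :* e)))
                refl (halfPow k′) (β ^ c) A (two ^ k′) (ε ^ suc c)

theorem3p1 : ∀ {q : ℕ} (𝔽 : FiniteField q) → IsPrimePower q →
    ∀ (m k : ℕ) → 2 ≤ m → m < k → (L : Sys 𝔽 m k) → LinIndep 𝔽 L →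
    (s : ℕ) → IsMinLength 𝔽 L s →
    (∃ λ n → 1 ≤ n × Σ (Pt 𝔽 n → ℚ) λ f → Bounded 𝔽 f × Balanced 𝔽 f ×
      Σ (List (CritEntry 𝔽 k (cOf s))) λ es → EnumeratesCrit 𝔽 L (cOf s) es × sumΛ 𝔽 es f <ℚ 0ℚ) →
    Uncommon 𝔽 L
theorem3p1 𝔽 _ m k _ m<k L _ s s-min (n , 1≤n , f , bounded , balanced , es , enum , ∑Λ<0) common =
  ℚ.<-irrefl refl (ℚ.≤-<-trans (common n 1≤n (λ x → ε * f̂ x) εf̂-bounded)
                               (Δ-< (ℕ.≤-trans (s≤s z≤n) m<k) (ε₀-small A (cOf s) k A<0)))
  where
  open Correlations 𝔽 L n f
  A : ℚ
  A = ∑ es (λ e → Λ 𝔽 (sys e) f̂)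
  A<0 : A <ℚ 0ℚ
  A<0 = subst (_<ℚ 0ℚ) (sym (∑-cong es (Λ-f̂ ∘ sys))) ∑Λ<0
  ε : ℚ
  ε = ε₀ A k
  open Estimate bounded balanced s s-min es enum ε (ε₀-pos A k A<0) (ε₀≤1 A k) using (Δ-<)
  εf̂-bounded : Bounded 𝔽 (λ x → ε * f̂ x)
  εf̂-bounded x = scaled-bounds ε (f̂ x) (ℚ.<⇒≤ (ε₀-pos A k A<0)) (ε₀≤1 A k) (proj₁ (bounded _)) (proj₂ (bounded _))
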